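{- Define $b$ on words over $\{1,2,u,d\}$ as follows: first substitute letter by letter $2\mapsto p$, $u\mapsto q$, $d\mapsto r$, $1\mapsto s$; then, if the resulting word contains the letter $r$, reverse the prefix that precedes the last occurrence of $r$ (leaving that last $r$ and everything after it unchanged). Then $b$ restricts to a length-preserving bijection $b: L_{\mathrm{Rect}}\to L_{\mathrm{Evil}}$, whose inverse $b^{ -1}: L_{\mathrm{Evil}}\to L_{\mathrm{Rect}}$ is given by first reversing the prefix preceding the last $r$ (if $r$ occurs) and then substituting $p\mapsto 2$, $q\mapsto u$, $r\mapsto d$, $s\mapsto 1$.
   Context: Permutations are in one-line form; $S_0=\{e_0\}$ (empty permutation), $e_n=[1\,2\cdots n]$. For $\pi\in S_n$, $1\le i,j\le n+1$, $\rho_{i,j}(\pi)\in S_{n+1}$ increases by $1$ every entry $\ge i$ and inserts value $i$ at position $j$. $\mathbb{1}_S$ is $1$ if $S$ holds, else $0$. Rectangular permutations avoid $2413,2431,4213,4231$. Operators: $\psi_1=\rho_{1,1}$ on all rectangular permutations; $\psi_2=\rho_{1,2}$ on rectangular $\pi$ of size $\ge2$ with $\pi_1\ne1$; $\psi_u(\pi)=\rho_{\pi_1,1}(\pi)$ on rectangular $\pi$ of size $\ge2$ with $\pi_1\neq1$; $\psi_d(\pi)=\rho_{\pi_1+1,1}(\pi)$ on rectangular $\pi$ of size $\ge1$. $L_{\mathrm{Rect}}$ is the set of nonempty words $w_1\cdots w_m$ over $\{1,2,u,d\}$ such that $\psi_{w_1}\circ\cdots\circ\psi_{w_m}$ can be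 applied to $e_0$ (each successive operator, starting with $\psi_{w_m}$, is applied to a permutation in its domain). Evil-avoiding permutations avoid $2413,4132,4213,3214$. Operators: $\psi_p=\rho_{1,1}$ on non-identity evil-avoiding permutations. $\psi_q$ on non-identity evil-avoiding $\pi\in S_n$: let $t$ be the least $i$ such that $i$ occurs after $i+1$ in $\pi$; call $\pi$ $(a,b)$-sandwiched ($a\ge0$, $b\ge1$) if $\pi_i=i$ for $i\le a$ and $\pi_{n-b+j}=a+j$ for $1\le j\le b$; if so, $\psi_q(\pi)=[a+b+1,1,\dots,a+1,\pi_{a+1}+1,\dots,\pi_{n-b}+1,a+2,\dots,a+b]$, otherwise $\psi_q(\pi)=[t+1,\pi_1+\mathbb{1}_{\pi_1>t},\dots,\pi_n+\mathbb{1}_{\pi_n>t}]$. $\psi_r(\pi)=[\pi_1+1,\dots,\pi_n+1,1]$ on evil-avoiding $\pi$ of size $n\ge1$. $\psi_s$ is defined on $e_0$ and on evil-avoiding $\pi\in S_n$ whose last $t$ entries are $1,\dots,t$ for some $t\ge1$, by $\psi_s(\pi)=\rho_{t+1,n+1}(\pi)$ ($t=0$ for $e_0$). $L_{\mathrm{Evil}}$ is the set of nonempty words $c_1\cdots c_m$ over $\{p,q,r,s\}$ such that $\psi_{c_1}\circ\cdots\circ\psi_{c_m}$ can be applied to $e_0$ with each operator applied within its domain. -}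

module Defs where

open import Data.Nat using (ℕ; zero; suc; _+_; _∸_; _≤_; _<_; _≤ᵇ_; _<ᵇ_)
open import Data.Bool using (Bool; true; false; if_then_else_)
open import Data.List using (List; []; _∷_; _++_; map; length; upTo; reverse; [_])
open import Data.List.Relation.Binary.Sublist.Propositional using (_⊆_)
open import Data.Product using (Σ; ∃; ∃-syntax; _×_; _,_)
open import Data.Sum using (_⊎_)
open import Data.Maybe using (Maybe; just; nothing)
open import Relation.Binary.PropositionalEquality using (_≡_; _≢_)
open import Relation.Nullary using (¬_)

-- Permutations in one-line form are lists of naturals.

range : ℕ → ℕ → List ℕ
range s k = map (s +_) (upTo k)

idPerm : ℕ → List ℕ
idPerm n = range 1 n

-- n-th entry (0-indexed), default 0
nth : List ℕ → ℕ → ℕ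
nth []       _       = 0
nth (x ∷ _)  zero    = x
nth (_ ∷ xs) (suc i) = nth xs i

OrderIso : List ℕ → List ℕ → Set
OrderIso s σ = length s ≡ length σ ×
  (∀ i j → i < length s → j < length s →
     (nth s i < nth s j → nth σ i < nth σ j) × (nth σ i < nth σ j → nth s i < nth s j))

Contains : List ℕ → List ℕ → Set
Contains π σ = ∃[ s ] (s ⊆ π × OrderIso s σ)

Avoids : List ℕ → List ℕ → Set
Avoids π σ = ¬ Contains π σ

Rectangular : List ℕ → Set
Rectangular π = Avoids π (2 ∷ 4 ∷ 1 ∷ 3 ∷ []) × Avoids π (2 ∷ 4 ∷ 3 ∷ 1 ∷ [])
              × Avoids π (4 ∷ 2 ∷ 1 ∷ 3 ∷ []) × Avoids π (4 ∷ 2 ∷ 3 ∷ 1 ∷ [])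

EvilAvoiding : List ℕ → Set
EvilAvoiding π = Avoids π (2 ∷ 4 ∷ 1 ∷ 3 ∷ []) × Avoids π (4 ∷ 1 ∷ 3 ∷ 2 ∷ [])
               × Avoids π (4 ∷ 2 ∷ 1 ∷ 3 ∷ []) × Avoids π (3 ∷ 2 ∷ 1 ∷ 4 ∷ [])

insertAt : ℕ → ℕ → List ℕ → List ℕ
insertAt zero    v xs       = v ∷ xs
insertAt (suc k) v []       = v ∷ []
insertAt (suc k) v (x ∷ xs) = x ∷ insertAt k v xs

-- ρ_{i,j}: increase every entry ≥ i by 1 and insert value i at position j (1-indexed)
rho : ℕ → ℕ → List ℕ → List ℕ
rho i j π = insertAt (j ∸ 1) i (map (λ x → if i ≤ᵇ x then suc x else x) π)

data RL : Set where
  one two u d : RL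

data StepR : RL → List ℕ → List ℕ → Set where
  st1 : ∀ {π} → Rectangular π → StepR one π (rho 1 1 π)
  st2 : ∀ {x y rest} → Rectangular (x ∷ y ∷ rest) → x ≢ 1 →
        StepR two (x ∷ y ∷ rest) (rho 1 2 (x ∷ y ∷ rest))
  stu : ∀ {x y rest} → Rectangular (x ∷ y ∷ rest) → x ≢ 1 →
        StepR u (x ∷ y ∷ rest) (rho x 1 (x ∷ y ∷ rest))
  std : ∀ {x rest} → Rectangular (x ∷ rest) →
        StepR d (x ∷ rest) (rho (suc x) 1 (x ∷ rest))

-- RunR w π : applying ψ_{w1} ∘ ... ∘ ψ_{wm} to e_0 (within domains) yields π
data RunR : List RL → List ℕ → Set where
  runNil  : RunR [] []
  runCons : ∀ {c w π π'} → RunR w π → StepR c π π' → RunR (c ∷ w) π'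

LRect : List RL → Set
LRect w = w ≢ [] × ∃[ π ] RunR w π

data EL : Set where
  p q r s : EL

NonIdentity : List ℕ → Set
NonIdentity π = π ≢ idPerm (length π)

OccursAfter : List ℕ → ℕ → Set
OccursAfter π i = ∃[ xs ] ∃[ ys ] ∃[ zs ] (π ≡ xs ++ (suc i ∷ ys) ++ (i ∷ zs))

IsLeastDescent : List ℕ → ℕ → Set
IsLeastDescent π t = 1 ≤ t × OccursAfter π t × (∀ i → 1 ≤ i → i < t → ¬ OccursAfter π i)

Sandwiched : ℕ → ℕ → List ℕ → List ℕ → Set
Sandwiched a b mid π = 1 ≤ b × π ≡ range 1 a ++ mid ++ range (suc a) b

data StepE : EL → List ℕ → List ℕ → Set where
  stp : ∀ {π} → EvilAvoiding π → NonIdentity π → StepE p π (rho 1 1 π)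
  stqSand : ∀ {π a b mid} → EvilAvoiding π → NonIdentity π → Sandwiched a b mid π →
        StepE q π (suc (a + b) ∷ range 1 (suc a) ++ map suc mid ++ range (2 + a) (b ∸ 1))
  stqNot : ∀ {π t} → EvilAvoiding π → NonIdentity π →
        ¬ (∃[ a ] ∃[ b ] ∃[ mid ] Sandwiched a b mid π) → IsLeastDescent π t →
        StepE q π (suc t ∷ map (λ x → if t <ᵇ x then suc x else x) π)
  str : ∀ {x rest} → EvilAvoiding (x ∷ rest) →
        StepE r (x ∷ rest) (map suc (x ∷ rest) ++ [ 1 ])
  stsEmpty : StepE s [] (rho 1 1 [])
  sts : ∀ {π mid t} → EvilAvoiding π → 1 ≤ t → π ≡ mid ++ range 1 t →
        StepE s π (rho (suc t) (suc (length π)) π)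

data RunE : List EL → List ℕ → Set where
  runNil  : RunE [] []
  runCons : ∀ {c w π π'} → RunE w π → StepE c π π' → RunE (c ∷ w) π'

LEvil : List EL → Set
LEvil w = w ≢ [] × ∃[ π ] RunE w π

substRE : RL → EL
substRE two = p
substRE u   = q
substRE d   = r
substRE one = s

substER : EL → RL
substER p = two
substER q = u
substER r = d
substER s = one

-- split w = x ++ r ∷ y with y containing no r (last occurrence of r), if any
splitLastR : List EL → Maybe (List EL × List EL)
splitLastR [] = nothing
splitLastR (c ∷ w) with splitLastR w
... | just (x , y) = just (c ∷ x , y)
splitLastR (p ∷ w) | nothing = nothing
splitLastR (q ∷ w) | nothing = nothing
splitLastR (r ∷ w) | nothing = just ([] , w)
splitLastR (s ∷ w) | nothing = nothing

revBeforeLastR : List EL → List EL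
revBeforeLastR w with splitLastR w
... | just (x , y) = reverse x ++ r ∷ y
... | nothing      = w

b : List RL → List EL
b w = revBeforeLastR (map substRE w)

bInv : List EL → List RL
bInv v = map substER (revBeforeLastR v)

module Submission where

-- The rectangular and the evil-avoiding classes are closed under the operators applied to them,
-- so whether an operator is applicable depends only on the shape of the current permutation:
-- for the rectangular operators, whether it is empty or starts with 1; for the evil-avoiding
-- ones, whether it is empty, an identity, or ends with a block 1 … t.  Runs are therefore
-- recognised by small automata: the two languages are the nonempty words of
-- 1* ∪ {1,2,u,d}* d 1⁺ without the factors 21, u1, and of s* ∪ {p,q,r,s}* r s⁺ without the
-- factors sp, sq.  Reversing the part before the last d (resp. r) turns the forbidden
-- factors of one language into those of the other.

open import Defs hiding (p; r; s; one; two; u; d)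
open import Data.Nat
open import Data.Nat.Properties
open import Data.Bool using (Bool; true; false; if_then_else_; T; _∧_)
open import Data.Bool.Properties using (∧-assoc; ∧-comm)
open import Data.Maybe using (Maybe; just; nothing; _>>=_)
open import Data.Maybe.Properties using (just-injective)
open import Data.List using (List; []; _∷_; _++_; map; length; [_]; applyUpTo; reverse; take; drop; foldr; replicate)
open import Data.List.Properties
  using (length-map; map-applyUpTo; ++-conicalʳ; foldr-++; map-replicate; map-cong-local; map-cong; map-∘; map-id; map-injective; ∷-injectiveˡ; ∷-injectiveʳ; length-++; map-++; ++-assoc; ∷ʳ-injective; take++drop≡id; ≡-dec; length-reverse; unfold-reverse; reverse-involutive)
open import Data.List.Membership.Propositional using (_∈_; _∉_)
open import Data.List.Membership.Propositional.Properties using (∈-map⁻; ∈-map⁺; ∈-++⁻; ∈-++⁺ˡ; ∈-++⁺ʳ)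
open import Data.List.Relation.Unary.Any using (here; there)
open import Data.List.Relation.Unary.All as All using (All; []; _∷_)
open import Data.List.Relation.Unary.All.Properties using (replicate⁺)
open import Data.List.Relation.Binary.Sublist.Propositional {A = ℕ}
  using (_⊆_; []; _∷_; _∷ʳ_; ⊆-trans; ⊆-refl; minimum; to∈; from∈)
open import Data.List.Relation.Binary.Sublist.Propositional.Properties
  using (∷ˡ⁻; ++⁺ˡ; ++⁺ʳ; All-resp-⊆; to-≋)
  renaming (map⁺ to ⊆-map⁺)
open import Data.List.Relation.Binary.Sublist.DecPropositional {A = ℕ} _≟_ using (_⊆?_)
open import Data.List.Relation.Binary.Equality.Propositional using (≋⇒≡)
open import Data.Product using (Σ; _×_; _,_; proj₁; proj₂)
open import Data.Sum using (_⊎_; inj₁; inj₂)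
open import Data.Empty using (⊥; ⊥-elim)
open import Data.Unit using (⊤; tt)
open import Function using (_∘_; case_of_; flip)
open import Relation.Binary.Core using (_Preserves_⟶_)
open import Relation.Binary.Definitions using (tri<; tri≈; tri>)
open import Relation.Binary.PropositionalEquality
  using (_≡_; _≢_; refl; sym; trans; cong; cong₂; subst; subst₂; module ≡-Reasoning)
open import Relation.Nullary using (¬_; Dec; yes; no)

bump : ℕ → ℕ → ℕ
bump i x = if i ≤ᵇ x then suc x else x

bump-cases : ∀ i x → (i ≤ x × bump i x ≡ suc x) ⊎ (x < i × bump i x ≡ x)
bump-cases i x with i ≤ᵇ x in eq
... | true  = inj₁ (≤ᵇ⇒≤ i x (subst T (sym eq) tt) , refl)
... | false = inj₂ (≰⇒> (λ i≤x → subst T eq (≤⇒≤ᵇ i≤x)) , refl)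

bump-≥ : ∀ i x → i ≤ x → bump i x ≡ suc x
bump-≥ i x i≤x with bump-cases i x
... | inj₁ (_ , e)   = e
... | inj₂ (x<i , _) = ⊥-elim (<⇒≱ x<i i≤x)

bump-< : ∀ i x → x < i → bump i x ≡ x
bump-< i x x<i with bump-cases i x
... | inj₁ (i≤x , _) = ⊥-elim (<⇒≱ x<i i≤x)
... | inj₂ (_ , e)   = e

bump-≢ : ∀ i x → bump i x ≢ i
bump-≢ i x with bump-cases i x
... | inj₁ (i≤x , e) = λ e′ → <-irrefl (trans (sym e′) e) (s≤s i≤x)
... | inj₂ (x<i , e) = λ e′ → <-irrefl (trans (sym e) e′) x<i

StrictMono : (ℕ → ℕ) → Set
StrictMono g = g Preserves _<_ ⟶ _<_

bump-mono : ∀ i → StrictMono (bump i)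
bump-mono i {x} {y} x<y with bump-cases i x | bump-cases i y
... | inj₁ (_ , e₁) | inj₁ (_ , e₂) rewrite e₁ | e₂ = s≤s x<y
... | inj₂ (_ , e₁) | inj₂ (_ , e₂) rewrite e₁ | e₂ = x<y
... | inj₂ (_ , e₁) | inj₁ (_ , e₂) rewrite e₁ | e₂ = m<n⇒m<1+n x<y
... | inj₁ (i≤x , _) | inj₂ (y<i , _) = ⊥-elim (<⇒≱ (<-trans x<y y<i) i≤x)

strictMono-reflects-< : ∀ {g} → StrictMono g → ∀ {x y} → g x < g y → x < y
strictMono-reflects-< {g} mono {x} {y} gx<gy with <-cmp x y
... | tri< x<y _ _ = x<y
... | tri≈ _ refl _ = ⊥-elim (<-irrefl refl gx<gy)
... | tri> _ _ y<x = ⊥-elim (<-asym gx<gy (mono y<x))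

strictMono-injective : ∀ {g} → StrictMono g → ∀ {x y} → g x ≡ g y → x ≡ y
strictMono-injective mono {x} {y} e with <-cmp x y
... | tri< x<y _ _ = ⊥-elim (<-irrefl e (mono x<y))
... | tri≈ _ x≡y _ = x≡y
... | tri> _ _ y<x = ⊥-elim (<-irrefl (sym e) (mono y<x))

range′ : ℕ → ℕ → List ℕ
range′ s zero    = []
range′ s (suc k) = s ∷ range′ (suc s) k

range≡range′ : ∀ s k → range s k ≡ range′ s k
range≡range′ s k = trans (map-applyUpTo (λ i → i) (s +_) k) (applyUpTo-shift (s +_) s k (λ _ → refl))
  where
  applyUpTo-shift : ∀ (h : ℕ → ℕ) s k → (∀ i → h i ≡ s + i) → applyUpTo h k ≡ range′ s k
  applyUpTo-shift h s zero    e = refl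
  applyUpTo-shift h s (suc k) e = cong₂ _∷_ (trans (e 0) (+-identityʳ s))
    (applyUpTo-shift (h ∘ suc) (suc s) k (λ i → trans (e (suc i)) (+-suc s i)))

length-range′ : ∀ s k → length (range′ s k) ≡ k
length-range′ s zero    = refl
length-range′ s (suc k) = cong suc (length-range′ (suc s) k)

range′-∷ʳ : ∀ s k → range′ s (suc k) ≡ range′ s k ++ [ s + k ]
range′-∷ʳ s zero    = cong [_] (sym (+-identityʳ s))
range′-∷ʳ s (suc k) = cong (s ∷_) (trans (range′-∷ʳ (suc s) k) (cong (λ z → range′ (suc s) k ++ [ z ]) (sym (+-suc s k))))

range′-++ : ∀ s k l → range′ s k ++ range′ (s + k) l ≡ range′ s (k + l)
range′-++ s zero    l = cong (λ z → range′ z l) (+-identityʳ s)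
range′-++ s (suc k) l = cong (s ∷_) (trans (cong (λ z → range′ (suc s) k ++ range′ z l) (+-suc s k)) (range′-++ (suc s) k l))

∈-range′⁻ : ∀ {x} s k → x ∈ range′ s k → s ≤ x × x < s + k
∈-range′⁻ s (suc k) (here refl) = ≤-refl , subst (s <_) (sym (+-suc s k)) (s≤s (m≤m+n s k))
∈-range′⁻ {x} s (suc k) (there x∈) with ∈-range′⁻ (suc s) k x∈
... | s<x , x< = <⇒≤ s<x , subst (x <_) (sym (+-suc s k)) x<

∈-range′⁺ : ∀ {x} s k → s ≤ x → x < s + k → x ∈ range′ s k
∈-range′⁺ {x} s zero    s≤x x< = ⊥-elim (<-irrefl refl (≤-<-trans s≤x (subst (x <_) (+-identityʳ s) x<)))
∈-range′⁺ {x} s (suc k) s≤x x< with m≤n⇒m<n∨m≡n s≤x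
... | inj₂ refl = here refl
... | inj₁ s<x  = there (∈-range′⁺ (suc s) k s<x (subst (x <_) (+-suc s k) x<))

map-bump-range′ : ∀ i s k → s + k ≤ i → map (bump i) (range′ s k) ≡ range′ s k
map-bump-range′ i s zero    _ = refl
map-bump-range′ i s (suc k) ≤i = cong₂ _∷_
  (bump-< i s (<-≤-trans (subst (s <_) (sym (+-suc s k)) (s≤s (m≤m+n s k))) ≤i))
  (map-bump-range′ i (suc s) k (subst (_≤ i) (+-suc s k) ≤i))

map-suc-range′ : ∀ s k → map suc (range′ s k) ≡ range′ (suc s) k
map-suc-range′ s zero    = refl
map-suc-range′ s (suc k) = cong (suc s ∷_) (map-suc-range′ (suc s) k)

Uniq : List ℕ → Set
Uniq []       = ⊤
Uniq (x ∷ xs) = x ∉ xs × Uniq xs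

Increasing : List ℕ → Set
Increasing L = ∀ x y → x ∷ y ∷ [] ⊆ L → x < y

range′-increasing : ∀ s k → Increasing (range′ s k)
range′-increasing s (suc k) x y (.s ∷ʳ sub) = range′-increasing (suc s) k x y sub
range′-increasing s (suc k) x y (refl ∷ sub) = proj₁ (∈-range′⁻ (suc s) k (to∈ sub))

uniq-range′ : ∀ s k → Uniq (range′ s k)
uniq-range′ s zero    = tt
uniq-range′ s (suc k) = (λ s∈ → <-irrefl refl (proj₁ (∈-range′⁻ (suc s) k s∈))) , uniq-range′ (suc s) k

uniq-⊆ : ∀ {A B} → A ⊆ B → Uniq B → Uniq A
uniq-⊆ []           _        = tt
uniq-⊆ (y ∷ʳ sub)   (_ , u)  = uniq-⊆ sub u
uniq-⊆ (refl ∷ sub) (y∉ , u) = (λ y∈ → y∉ (to∈ (⊆-trans (from∈ y∈) sub))) , uniq-⊆ sub u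

uniq-map : ∀ {g} → StrictMono g → ∀ π → Uniq π → Uniq (map g π)
uniq-map mono []      _        = tt
uniq-map {g} mono (x ∷ π) (x∉ , u) = gx∉ , uniq-map mono π u
  where
  gx∉ : g x ∉ map g π
  gx∉ gx∈ with ∈-map⁻ g gx∈
  ... | y , y∈ , e = x∉ (subst (_∈ π) (sym (strictMono-injective mono e)) y∈)

uniq-++ : ∀ A B → Uniq A → Uniq B → (∀ x → x ∈ A → x ∉ B) → Uniq (A ++ B)
uniq-++ []      B _          uB _        = uB
uniq-++ (x ∷ A) B (x∉ , uA) uB disjoint = x∉A++B , uniq-++ A B uA uB (λ y y∈ → disjoint y (there y∈))
  where
  x∉A++B : x ∉ A ++ B
  x∉A++B x∈ with ∈-++⁻ A x∈
  ... | inj₁ x∈A = x∉ x∈A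
  ... | inj₂ x∈B = disjoint x (here refl) x∈B

uniq-++⁻ʳ : ∀ A B → Uniq (A ++ B) → Uniq B
uniq-++⁻ʳ []      B u       = u
uniq-++⁻ʳ (x ∷ A) B (_ , u) = uniq-++⁻ʳ A B u

uniq-++-disjoint : ∀ A B {x} → Uniq (A ++ B) → x ∈ A → x ∉ B
uniq-++-disjoint (a ∷ A) B (a∉ , u) (here refl) x∈B = a∉ (∈-++⁺ʳ A x∈B)
uniq-++-disjoint (a ∷ A) B (_ , u)  (there x∈A) x∈B = uniq-++-disjoint A B u x∈A x∈B

either-order : ∀ {x y} L → x ≢ y → x ∈ L → y ∈ L → x ∷ y ∷ [] ⊆ L ⊎ y ∷ x ∷ [] ⊆ L
either-order (z ∷ L) x≢y (here refl) (here refl) = ⊥-elim (x≢y refl)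
either-order (z ∷ L) x≢y (here refl) (there y∈)  = inj₁ (refl ∷ from∈ y∈)
either-order (z ∷ L) x≢y (there x∈)  (here refl) = inj₂ (refl ∷ from∈ x∈)
either-order (z ∷ L) x≢y (there x∈)  (there y∈) with either-order L x≢y x∈ y∈
... | inj₁ sub = inj₁ (z ∷ʳ sub)
... | inj₂ sub = inj₂ (z ∷ʳ sub)

¬both-orders : ∀ {x y} L → Uniq L → x ∷ y ∷ [] ⊆ L → y ∷ x ∷ [] ⊆ L → ⊥
¬both-orders (z ∷ L) (_ , u)  (.z ∷ʳ xy) (.z ∷ʳ yx) = ¬both-orders L u xy yx
¬both-orders (z ∷ L) (z∉ , _) (.z ∷ʳ xy) (refl ∷ yx) = z∉ (to∈ (∷ˡ⁻ xy))
¬both-orders (z ∷ L) (z∉ , _) (refl ∷ xy) (.z ∷ʳ yx) = z∉ (to∈ (∷ˡ⁻ yx))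
¬both-orders (z ∷ L) (z∉ , _) (refl ∷ xy) (refl ∷ yx) = z∉ (to∈ yx)

last-∈ : ∀ {m} xs {L} → xs ++ [ m ] ⊆ L → m ∈ L
last-∈ []       sub = to∈ sub
last-∈ (x ∷ xs) sub = last-∈ xs (∷ˡ⁻ sub)

⊆-glue : ∀ {m} xs ys L → Uniq L → xs ++ [ m ] ⊆ L → m ∷ ys ⊆ L → xs ++ m ∷ ys ⊆ L
⊆-glue []       ys L       u         sub₁ sub₂ = sub₂
⊆-glue (x ∷ xs) ys (z ∷ L) (z∉ , u) (.z ∷ʳ sub₁) (.z ∷ʳ sub₂) = z ∷ʳ ⊆-glue (x ∷ xs) ys L u sub₁ sub₂
⊆-glue (x ∷ xs) ys (z ∷ L) (z∉ , u) (.z ∷ʳ sub₁) (refl ∷ sub₂) = ⊥-elim (z∉ (last-∈ (x ∷ xs) sub₁))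
⊆-glue (x ∷ xs) ys (z ∷ L) (z∉ , u) (refl ∷ sub₁) (.z ∷ʳ sub₂) = refl ∷ ⊆-glue xs ys L u sub₁ sub₂
⊆-glue (x ∷ xs) ys (z ∷ L) (z∉ , u) (refl ∷ sub₁) (refl ∷ sub₂) = ⊥-elim (z∉ (last-∈ xs sub₁))

⊆-map⁻ : ∀ (g : ℕ → ℕ) {σ} π → σ ⊆ map g π → Σ (List ℕ) λ σ′ → σ′ ⊆ π × σ ≡ map g σ′
⊆-map⁻ g []      [] = [] , [] , refl
⊆-map⁻ g (x ∷ π) (.(g x) ∷ʳ sub) with ⊆-map⁻ g π sub
... | σ′ , sub′ , e = σ′ , x ∷ʳ sub′ , e
⊆-map⁻ g (x ∷ π) (refl ∷ sub) with ⊆-map⁻ g π sub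
... | σ′ , sub′ , e = x ∷ σ′ , refl ∷ sub′ , cong (g x ∷_) e

⊆-skipˡ-head : ∀ {Q : ℕ → Set} {x σ} A B → All (¬_ ∘ Q) A → Q x → x ∷ σ ⊆ A ++ B → x ∷ σ ⊆ B
⊆-skipˡ-head []      B _           _  sub            = sub
⊆-skipˡ-head (a ∷ A) B (_ ∷ ¬QA)   Qx (.a ∷ʳ sub)    = ⊆-skipˡ-head A B ¬QA Qx sub
⊆-skipˡ-head (a ∷ A) B (¬Qa ∷ _)   Qx (refl ∷ sub)   = ⊥-elim (¬Qa Qx)

⊆-skipˡ : ∀ {Q : ℕ → Set} {σ} M B → All Q σ → All (¬_ ∘ Q) M → σ ⊆ M ++ B → σ ⊆ B
⊆-skipˡ []      B _          _          sub          = sub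
⊆-skipˡ (m ∷ M) B Qσ         (_ ∷ ¬QM)  (.m ∷ʳ sub)  = ⊆-skipˡ M B Qσ ¬QM sub
⊆-skipˡ (m ∷ M) B (Qm ∷ _)   (¬Qm ∷ _)  (refl ∷ sub) = ⊥-elim (¬Qm Qm)

⊆-skipʳ : ∀ {Q : ℕ → Set} {σ} M B → All Q σ → All (¬_ ∘ Q) B → σ ⊆ M ++ B → σ ⊆ M
⊆-skipʳ {σ = []}    M       B _          _   _            = minimum M
⊆-skipʳ {σ = x ∷ σ} []      B (Qx ∷ _)   ¬QB sub          = ⊥-elim (All.lookup ¬QB (to∈ sub) Qx)
⊆-skipʳ             (m ∷ M) B Qσ         ¬QB (.m ∷ʳ sub)  = m ∷ʳ ⊆-skipʳ M B Qσ ¬QB sub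
⊆-skipʳ             (m ∷ M) B (_ ∷ Qσ)   ¬QB (refl ∷ sub) = refl ∷ ⊆-skipʳ M B Qσ ¬QB sub

⊆-skip-middle : ∀ {Q : ℕ → Set} {σ} A M B → All Q σ → All (¬_ ∘ Q) M → σ ⊆ A ++ M ++ B → σ ⊆ A ++ B
⊆-skip-middle []      M B Qσ       ¬QM sub          = ⊆-skipˡ M B Qσ ¬QM sub
⊆-skip-middle (x ∷ A) M B Qσ       ¬QM (.x ∷ʳ sub)  = x ∷ʳ ⊆-skip-middle A M B Qσ ¬QM sub
⊆-skip-middle (x ∷ A) M B (_ ∷ Qσ) ¬QM (refl ∷ sub) = refl ∷ ⊆-skip-middle A M B Qσ ¬QM sub

⊆-within-middle : ∀ {Q : ℕ → Set} {σ} A M B → All Q σ → All (¬_ ∘ Q) A → All (¬_ ∘ Q) B → σ ⊆ A ++ M ++ B → σ ⊆ M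
⊆-within-middle []      M B Qσ        _          ¬QB sub          = ⊆-skipʳ M B Qσ ¬QB sub
⊆-within-middle (x ∷ A) M B Qσ        (_ ∷ ¬QA)  ¬QB (.x ∷ʳ sub)  = ⊆-within-middle A M B Qσ ¬QA ¬QB sub
⊆-within-middle (x ∷ A) M B (Qx ∷ _)  (¬Qx ∷ _)  ¬QB (refl ∷ sub) = ⊥-elim (¬Qx Qx)

⊆-∷-split : ∀ {x σ} L → x ∷ σ ⊆ L → Σ (List ℕ) λ A → Σ (List ℕ) λ B → L ≡ A ++ x ∷ B × σ ⊆ B
⊆-∷-split (y ∷ L) (.y ∷ʳ sub) with ⊆-∷-split L sub
... | A , B , e , sub′ = y ∷ A , B , cong (y ∷_) e , sub′
⊆-∷-split (y ∷ L) (refl ∷ sub) = [] , L , refl , sub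

⊆-∷ʳ-cases : ∀ {v} σ xs → σ ⊆ xs ++ [ v ] → σ ⊆ xs ⊎ Σ (List ℕ) λ σ′ → σ ≡ σ′ ++ [ v ] × σ′ ⊆ xs
⊆-∷ʳ-cases []          []       _            = inj₁ []
⊆-∷ʳ-cases (x ∷ [])    []       (refl ∷ [])  = inj₂ ([] , refl , [])
⊆-∷ʳ-cases (x ∷ y ∷ σ) []       (refl ∷ ())
⊆-∷ʳ-cases σ           (x ∷ xs) (.x ∷ʳ sub) with ⊆-∷ʳ-cases σ xs sub
... | inj₁ sub′            = inj₁ (x ∷ʳ sub′)
... | inj₂ (σ′ , e , sub′) = inj₂ (σ′ , e , x ∷ʳ sub′)
⊆-∷ʳ-cases (x ∷ σ)     (x ∷ xs) (refl ∷ sub) with ⊆-∷ʳ-cases σ xs sub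
... | inj₁ sub′            = inj₁ (refl ∷ sub′)
... | inj₂ (σ′ , e , sub′) = inj₂ (x ∷ σ′ , cong (x ∷_) e , refl ∷ sub′)

data Pat : Set where
  P2413 P2431 P4213 P4231 P4132 P3214 : Pat

pat : Pat → List ℕ
pat P2413 = 2 ∷ 4 ∷ 1 ∷ 3 ∷ []
pat P2431 = 2 ∷ 4 ∷ 3 ∷ 1 ∷ []
pat P4213 = 4 ∷ 2 ∷ 1 ∷ 3 ∷ []
pat P4231 = 4 ∷ 2 ∷ 3 ∷ 1 ∷ []
pat P4132 = 4 ∷ 1 ∷ 3 ∷ 2 ∷ []
pat P3214 = 3 ∷ 2 ∷ 1 ∷ 4 ∷ []

Matches : Pat → ℕ → ℕ → ℕ → ℕ → Set
Matches P2413 a b c d = c < a × a < d × d < b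
Matches P2431 a b c d = d < a × a < c × c < b
Matches P4213 a b c d = c < b × b < d × d < a
Matches P4231 a b c d = d < b × b < c × c < a
Matches P4132 a b c d = b < d × d < c × c < a
Matches P3214 a b c d = c < b × b < a × a < d

L3 : ℕ → ℕ → ℕ → List ℕ
L3 a b c = a ∷ b ∷ c ∷ []

L4 : ℕ → ℕ → ℕ → ℕ → List ℕ
L4 a b c d = a ∷ b ∷ c ∷ d ∷ []

Occurrence : Pat → List ℕ → Set
Occurrence P π = Σ ℕ λ a → Σ ℕ λ b → Σ ℕ λ c → Σ ℕ λ d → L4 a b c d ⊆ π × Matches P a b c d

<-literal : ∀ m n → {T (m <ᵇ n)} → m < n
<-literal m n {m<ᵇn} = <ᵇ⇒< m n m<ᵇn

contains⇒occurrence : ∀ P {π} → Contains π (pat P) → Occurrence P π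
contains⇒occurrence P {π} (σ , sub , σ≈P , iso) = go P σ sub σ≈P (λ i j i<4 j<4 → proj₂ (iso i j i<4 j<4))
  where
  lit = <-literal
  Back : Pat → List ℕ → Set
  Back P σ = ∀ i j → i < length σ → j < length σ → nth (pat P) i < nth (pat P) j → nth σ i < nth σ j
  -- The three comparisons are those between the positions of the values 1 < 2 < 3 < 4 of the pattern.
  go : ∀ P σ → σ ⊆ π → length σ ≡ length (pat P) → Back P σ → Occurrence P π
  go P2413 (a ∷ b ∷ c ∷ d ∷ []) sub _ f = a , b , c , d , sub ,
    f 2 0 (lit 2 4) (lit 0 4) (lit 1 2) , f 0 3 (lit 0 4) (lit 3 4) (lit 2 3) , f 3 1 (lit 3 4) (lit 1 4) (lit 3 4)
  go P2431 (a ∷ b ∷ c ∷ d ∷ []) sub _ f = a , b , c , d , sub ,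
    f 3 0 (lit 3 4) (lit 0 4) (lit 1 2) , f 0 2 (lit 0 4) (lit 2 4) (lit 2 3) , f 2 1 (lit 2 4) (lit 1 4) (lit 3 4)
  go P4213 (a ∷ b ∷ c ∷ d ∷ []) sub _ f = a , b , c , d , sub ,
    f 2 1 (lit 2 4) (lit 1 4) (lit 1 2) , f 1 3 (lit 1 4) (lit 3 4) (lit 2 3) , f 3 0 (lit 3 4) (lit 0 4) (lit 3 4)
  go P4231 (a ∷ b ∷ c ∷ d ∷ []) sub _ f = a , b , c , d , sub ,
    f 3 1 (lit 3 4) (lit 1 4) (lit 1 2) , f 1 2 (lit 1 4) (lit 2 4) (lit 2 3) , f 2 0 (lit 2 4) (lit 0 4) (lit 3 4)
  go P4132 (a ∷ b ∷ c ∷ d ∷ []) sub _ f = a , b , c , d , sub ,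
    f 1 3 (lit 1 4) (lit 3 4) (lit 1 2) , f 3 2 (lit 3 4) (lit 2 4) (lit 2 3) , f 2 0 (lit 2 4) (lit 0 4) (lit 3 4)
  go P3214 (a ∷ b ∷ c ∷ d ∷ []) sub _ f = a , b , c , d , sub ,
    f 2 1 (lit 2 4) (lit 1 4) (lit 1 2) , f 1 0 (lit 1 4) (lit 0 4) (lit 2 3) , f 0 3 (lit 0 4) (lit 3 4) (lit 3 4)
  go P2413 (_ ∷ _ ∷ _ ∷ _ ∷ _ ∷ _) _ () _
  go P2431 (_ ∷ _ ∷ _ ∷ _ ∷ _ ∷ _) _ () _
  go P4213 (_ ∷ _ ∷ _ ∷ _ ∷ _ ∷ _) _ () _
  go P4231 (_ ∷ _ ∷ _ ∷ _ ∷ _ ∷ _) _ () _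
  go P4132 (_ ∷ _ ∷ _ ∷ _ ∷ _ ∷ _) _ () _
  go P3214 (_ ∷ _ ∷ _ ∷ _ ∷ _ ∷ _) _ () _

nth-map : ∀ (f : ℕ → ℕ) σ i → i < length σ → nth (map f σ) i ≡ f (nth σ i)
nth-map f (x ∷ σ) zero    _         = refl
nth-map f (x ∷ σ) (suc i) (s≤s i<) = nth-map f σ i i<

nth-All : ∀ {Q : ℕ → Set} σ i → All Q σ → i < length σ → Q (nth σ i)
nth-All (x ∷ σ) zero    (Qx ∷ _) _         = Qx
nth-All (x ∷ σ) (suc i) (_ ∷ Qσ) (s≤s i<) = nth-All σ i Qσ i<

order-iso-map : ∀ σ (f : ℕ → ℕ) →
  (∀ i j → i < length σ → j < length σ → nth σ i < nth σ j → f (nth σ i) < f (nth σ j)) →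
  OrderIso (map f σ) σ
order-iso-map σ f mono = length-map f σ , λ i j i< j< →
  let i<′ = subst (i <_) (length-map f σ) i<
      j<′ = subst (j <_) (length-map f σ) j<
      eᵢ  = nth-map f σ i i<′
      eⱼ  = nth-map f σ j j<′
  in (λ lt → reflect i j i<′ j<′ (subst₂ _<_ eᵢ eⱼ lt)) , (λ lt → subst₂ _<_ (sym eᵢ) (sym eⱼ) (mono i j i<′ j<′ lt))
  where
  reflect : ∀ i j → i < length σ → j < length σ → f (nth σ i) < f (nth σ j) → nth σ i < nth σ j
  reflect i j i< j< lt with <-cmp (nth σ i) (nth σ j)
  ... | tri< x<y _ _ = x<y
  ... | tri≈ _ x≡y _ = ⊥-elim (<-irrefl (cong f x≡y) lt)
  ... | tri> _ _ y<x = ⊥-elim (<-asym lt (mono j i j< i< y<x))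

interpolate : ℕ → ℕ → ℕ → ℕ → ℕ → ℕ
interpolate w₁ w₂ w₃ w₄ 1 = w₁
interpolate w₁ w₂ w₃ w₄ 2 = w₂
interpolate w₁ w₂ w₃ w₄ 3 = w₃
interpolate w₁ w₂ w₃ w₄ _ = w₄

interpolate-step : ∀ {w₁ w₂ w₃ w₄} → w₁ < w₂ → w₂ < w₃ → w₃ < w₄ →
  ∀ x → 0 < x → x < 4 → interpolate w₁ w₂ w₃ w₄ x < interpolate w₁ w₂ w₃ w₄ (suc x)
interpolate-step w₁₂ w₂₃ w₃₄ 1 _ _ = w₁₂
interpolate-step w₁₂ w₂₃ w₃₄ 2 _ _ = w₂₃
interpolate-step w₁₂ w₂₃ w₃₄ 3 _ _ = w₃₄
interpolate-step w₁₂ w₂₃ w₃₄ (suc (suc (suc (suc _)))) _ (s≤s (s≤s (s≤s (s≤s ()))))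

interpolate-mono : ∀ {w₁ w₂ w₃ w₄} → w₁ < w₂ → w₂ < w₃ → w₃ < w₄ →
  ∀ x y → 0 < x → x < y → y < 5 → interpolate w₁ w₂ w₃ w₄ x < interpolate w₁ w₂ w₃ w₄ y
interpolate-mono w₁₂ w₂₃ w₃₄ x (suc y) 0<x (s≤s x≤y) (s≤s y<4) with m≤n⇒m<n∨m≡n x≤y
... | inj₂ refl = interpolate-step w₁₂ w₂₃ w₃₄ x 0<x y<4
... | inj₁ x<y  = <-trans (interpolate-mono w₁₂ w₂₃ w₃₄ x y 0<x x<y (m<n⇒m<1+n y<4))
                          (interpolate-step w₁₂ w₂₃ w₃₄ y (<-trans 0<x x<y) y<4)

pat-values : ∀ P → All (λ v → 0 < v × v < 5) (pat P)
pat-values P = All.tabulate λ {v} v∈ → bounds (pat P) (values P) v∈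
  where
  values : ∀ P → All (λ v → T (0 <ᵇ v) × T (v <ᵇ 5)) (pat P)
  values P2413 = _ ∷ _ ∷ _ ∷ _ ∷ []
  values P2431 = _ ∷ _ ∷ _ ∷ _ ∷ []
  values P4213 = _ ∷ _ ∷ _ ∷ _ ∷ []
  values P4231 = _ ∷ _ ∷ _ ∷ _ ∷ []
  values P4132 = _ ∷ _ ∷ _ ∷ _ ∷ []
  values P3214 = _ ∷ _ ∷ _ ∷ _ ∷ []
  bounds : ∀ σ → All (λ v → T (0 <ᵇ v) × T (v <ᵇ 5)) σ → ∀ {v} → v ∈ σ → 0 < v × v < 5
  bounds σ bs {v} v∈ with All.lookup bs v∈
  ... | b₀ , b₅ = <ᵇ⇒< 0 v b₀ , <ᵇ⇒< v 5 b₅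

-- An occurrence a b c d is the image of the pattern under the interpolation of its sorted values.
interpolate-iso : ∀ P {w₁ w₂ w₃ w₄} → w₁ < w₂ → w₂ < w₃ → w₃ < w₄ →
  OrderIso (map (interpolate w₁ w₂ w₃ w₄) (pat P)) (pat P)
interpolate-iso P w₁₂ w₂₃ w₃₄ = order-iso-map (pat P) _ λ i j i< j< lt →
  interpolate-mono w₁₂ w₂₃ w₃₄ _ _ (proj₁ (nth-All (pat P) i (pat-values P) i<)) lt (proj₂ (nth-All (pat P) j (pat-values P) j<))

occurrence⇒contains : ∀ P {π} → Occurrence P π → Contains π (pat P)
occurrence⇒contains P2413 (a , b , c , d , sub , x , y , z) = L4 a b c d , sub , interpolate-iso P2413 x y z
occurrence⇒contains P2431 (a , b , c , d , sub , x , y , z) = L4 a b c d , sub , interpolate-iso P2431 x y z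
occurrence⇒contains P4213 (a , b , c , d , sub , x , y , z) = L4 a b c d , sub , interpolate-iso P4213 x y z
occurrence⇒contains P4231 (a , b , c , d , sub , x , y , z) = L4 a b c d , sub , interpolate-iso P4231 x y z
occurrence⇒contains P4132 (a , b , c , d , sub , x , y , z) = L4 a b c d , sub , interpolate-iso P4132 x y z
occurrence⇒contains P3214 (a , b , c , d , sub , x , y , z) = L4 a b c d , sub , interpolate-iso P3214 x y z

matches-reflect : ∀ P {g : ℕ → ℕ} → StrictMono g → ∀ {a b c d} → Matches P (g a) (g b) (g c) (g d) → Matches P a b c d
matches-reflect P2413 mono (x , y , z) = strictMono-reflects-< mono x , strictMono-reflects-< mono y , strictMono-reflects-< mono z
matches-reflect P2431 mono (x , y , z) = strictMono-reflects-< mono x , strictMono-reflects-< mono y , strictMono-reflects-< mono z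
matches-reflect P4213 mono (x , y , z) = strictMono-reflects-< mono x , strictMono-reflects-< mono y , strictMono-reflects-< mono z
matches-reflect P4231 mono (x , y , z) = strictMono-reflects-< mono x , strictMono-reflects-< mono y , strictMono-reflects-< mono z
matches-reflect P4132 mono (x , y , z) = strictMono-reflects-< mono x , strictMono-reflects-< mono y , strictMono-reflects-< mono z
matches-reflect P3214 mono (x , y , z) = strictMono-reflects-< mono x , strictMono-reflects-< mono y , strictMono-reflects-< mono z

occurrence-map⁻ : ∀ P {g} → StrictMono g → ∀ π → Occurrence P (map g π) → Occurrence P π
occurrence-map⁻ P {g} mono π (_ , _ , _ , _ , sub , m) with ⊆-map⁻ g π sub
... | (a ∷ b ∷ c ∷ d ∷ []) , sub′ , refl = a , b , c , d , sub′ , matches-reflect P mono m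

occurrence-⊆ : ∀ P {π π′} → π ⊆ π′ → Occurrence P π → Occurrence P π′
occurrence-⊆ P π⊆π′ (a , b , c , d , sub , m) = a , b , c , d , ⊆-trans sub π⊆π′ , m

occurrence-∷ : ∀ P {v L} → Occurrence P (v ∷ L) →
  Occurrence P L ⊎ Σ ℕ λ b → Σ ℕ λ c → Σ ℕ λ d → L3 b c d ⊆ L × Matches P v b c d
occurrence-∷ P (a , b , c , d , (_ ∷ʳ sub) , m) = inj₁ (a , b , c , d , sub , m)
occurrence-∷ P (a , b , c , d , (refl ∷ sub) , m) = inj₂ (b , c , d , sub , m)

occurrence-∷ʳ : ∀ P {v} L → Occurrence P (L ++ [ v ]) →
  Occurrence P L ⊎ Σ ℕ λ a → Σ ℕ λ b → Σ ℕ λ c → L3 a b c ⊆ L × Matches P a b c v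
occurrence-∷ʳ P L (a , b , c , d , sub , m) with ⊆-∷ʳ-cases (L4 a b c d) L sub
... | inj₁ sub′ = inj₁ (a , b , c , d , sub′ , m)
... | inj₂ ((_ ∷ _ ∷ _ ∷ []) , refl , sub′) = inj₂ (a , b , c , sub′ , m)
... | inj₂ ((_ ∷ _ ∷ _ ∷ _ ∷ σ) , e , _) = case ++-conicalʳ σ _ (sym (cong (drop 4) e)) of λ ()

AvoidsRect AvoidsEvil : List ℕ → Set
AvoidsRect π = ¬ Occurrence P2413 π × ¬ Occurrence P2431 π × ¬ Occurrence P4213 π × ¬ Occurrence P4231 π
AvoidsEvil π = ¬ Occurrence P2413 π × ¬ Occurrence P4132 π × ¬ Occurrence P4213 π × ¬ Occurrence P3214 π

avoids⇒¬occurrence : ∀ P {π} → Avoids π (pat P) → ¬ Occurrence P π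
avoids⇒¬occurrence P av o = av (occurrence⇒contains P o)

¬occurrence⇒avoids : ∀ P {π} → ¬ Occurrence P π → Avoids π (pat P)
¬occurrence⇒avoids P ¬o c = ¬o (contains⇒occurrence P c)

avoidsRect⇒rectangular : ∀ {π} → AvoidsRect π → Rectangular π
avoidsRect⇒rectangular (a , b , c , d) =
  ¬occurrence⇒avoids P2413 a , ¬occurrence⇒avoids P2431 b , ¬occurrence⇒avoids P4213 c , ¬occurrence⇒avoids P4231 d

evilAvoiding⇒avoidsEvil : ∀ {π} → EvilAvoiding π → AvoidsEvil π
evilAvoiding⇒avoidsEvil (a , b , c , d) =
  avoids⇒¬occurrence P2413 a , avoids⇒¬occurrence P4132 b , avoids⇒¬occurrence P4213 c , avoids⇒¬occurrence P3214 d

avoidsEvil⇒evilAvoiding : ∀ {π} → AvoidsEvil π → EvilAvoiding π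
avoidsEvil⇒evilAvoiding (a , b , c , d) =
  ¬occurrence⇒avoids P2413 a , ¬occurrence⇒avoids P4132 b , ¬occurrence⇒avoids P4213 c , ¬occurrence⇒avoids P3214 d

pick₁₂ : ∀ {a b c d L} → L4 a b c d ⊆ L → a ∷ b ∷ [] ⊆ L
pick₁₂ sub = ⊆-trans (refl ∷ refl ∷ _ ∷ʳ _ ∷ʳ []) sub
pick₁₃ : ∀ {a b c d L} → L4 a b c d ⊆ L → a ∷ c ∷ [] ⊆ L
pick₁₃ sub = ⊆-trans (refl ∷ _ ∷ʳ refl ∷ _ ∷ʳ []) sub
pick₂₃ : ∀ {a b c d L} → L4 a b c d ⊆ L → b ∷ c ∷ [] ⊆ L
pick₂₃ sub = ⊆-trans (_ ∷ʳ refl ∷ refl ∷ _ ∷ʳ []) sub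
pick₃₄ : ∀ {a b c d L} → L4 a b c d ⊆ L → c ∷ d ∷ [] ⊆ L
pick₃₄ sub = ⊆-trans (_ ∷ʳ _ ∷ʳ refl ∷ refl ∷ []) sub
pick₁₂₃ : ∀ {a b c d L} → L4 a b c d ⊆ L → L3 a b c ⊆ L
pick₁₂₃ sub = ⊆-trans (refl ∷ refl ∷ refl ∷ _ ∷ʳ []) sub
pick₂₃₄ : ∀ {a b c d L} → L4 a b c d ⊆ L → L3 b c d ⊆ L
pick₂₃₄ sub = ⊆-trans (_ ∷ʳ refl ∷ refl ∷ refl ∷ []) sub
pick³₁₂ : ∀ {a b c L} → L3 a b c ⊆ L → a ∷ b ∷ [] ⊆ L
pick³₁₂ sub = ⊆-trans (refl ∷ refl ∷ _ ∷ʳ []) sub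
pick³₁₃ : ∀ {a b c L} → L3 a b c ⊆ L → a ∷ c ∷ [] ⊆ L
pick³₁₃ sub = ⊆-trans (refl ∷ _ ∷ʳ refl ∷ []) sub
pick³₂₃ : ∀ {a b c L} → L3 a b c ⊆ L → b ∷ c ∷ [] ⊆ L
pick³₂₃ sub = ⊆-trans (_ ∷ʳ refl ∷ refl ∷ []) sub

record IsPerm (π : List ℕ) : Set where
  constructor isPerm
  field
    uniq     : Uniq π
    bounded  : ∀ v → v ∈ π → 1 ≤ v × v ≤ length π
    complete : ∀ v → 1 ≤ v → v ≤ length π → v ∈ π
open IsPerm

perm-positive : ∀ {π} → IsPerm π → ∀ x → x ∈ π → 1 ≤ x
perm-positive pp x x∈ = proj₁ (bounded pp x x∈)

range′-isPerm : ∀ n → IsPerm (range′ 1 n)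
range′-isPerm n = isPerm (uniq-range′ 1 n)
  (λ v v∈ → case ∈-range′⁻ 1 n v∈ of λ where (1≤v , v<) → 1≤v , subst (v ≤_) (sym (length-range′ 1 n)) (≤-pred v<))
  (λ v 1≤v v≤ → ∈-range′⁺ 1 n 1≤v (s≤s (subst (v ≤_) (length-range′ 1 n) v≤)))

∈-insertAt : ∀ k v xs → v ∈ insertAt k v xs
∈-insertAt zero    v xs       = here refl
∈-insertAt (suc k) v []       = here refl
∈-insertAt (suc k) v (x ∷ xs) = there (∈-insertAt k v xs)

∈-insertAt⁺ : ∀ k v {y} xs → y ∈ xs → y ∈ insertAt k v xs
∈-insertAt⁺ zero    v xs       y∈          = there y∈
∈-insertAt⁺ (suc k) v (x ∷ xs) (here e)    = here e
∈-insertAt⁺ (suc k) v (x ∷ xs) (there y∈) = there (∈-insertAt⁺ k v xs y∈)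

∈-insertAt⁻ : ∀ k v {y} xs → y ∈ insertAt k v xs → y ≡ v ⊎ y ∈ xs
∈-insertAt⁻ zero    v xs       (here e)    = inj₁ e
∈-insertAt⁻ zero    v xs       (there y∈) = inj₂ y∈
∈-insertAt⁻ (suc k) v []       (here e)    = inj₁ e
∈-insertAt⁻ (suc k) v (x ∷ xs) (here e)    = inj₂ (here e)
∈-insertAt⁻ (suc k) v (x ∷ xs) (there y∈) with ∈-insertAt⁻ k v xs y∈
... | inj₁ e   = inj₁ e
... | inj₂ y∈′ = inj₂ (there y∈′)

length-insertAt : ∀ k v xs → length (insertAt k v xs) ≡ suc (length xs)
length-insertAt zero    v xs       = refl
length-insertAt (suc k) v []       = refl
length-insertAt (suc k) v (x ∷ xs) = cong suc (length-insertAt k v xs)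

insertAt-length : ∀ xs v → insertAt (length xs) v xs ≡ xs ++ [ v ]
insertAt-length []       v = refl
insertAt-length (x ∷ xs) v = cong (x ∷_) (insertAt-length xs v)

uniq-insertAt : ∀ k v xs → v ∉ xs → Uniq xs → Uniq (insertAt k v xs)
uniq-insertAt zero    v xs       v∉ u         = v∉ , u
uniq-insertAt (suc k) v []       v∉ u         = (λ ()) , tt
uniq-insertAt (suc k) v (x ∷ xs) v∉ (x∉ , u) = x∉′ , uniq-insertAt k v xs (v∉ ∘ there) u
  where
  x∉′ : x ∉ insertAt k v xs
  x∉′ x∈ with ∈-insertAt⁻ k v xs x∈
  ... | inj₁ e   = v∉ (here (sym e))
  ... | inj₂ x∈′ = x∉ x∈′

length-rho : ∀ i j π → length (rho i j π) ≡ suc (length π)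
length-rho i j π = trans (length-insertAt (j ∸ 1) i (map (bump i) π)) (cong suc (length-map (bump i) π))

rho-isPerm : ∀ i j π → IsPerm π → 1 ≤ i → i ≤ suc (length π) → IsPerm (rho i j π)
rho-isPerm i j π pp 1≤i i≤ = isPerm uniq′ bounded′ complete′
  where
  L = map (bump i) π
  uniq′ : Uniq (rho i j π)
  uniq′ = uniq-insertAt (j ∸ 1) i L
    (λ i∈ → case ∈-map⁻ (bump i) i∈ of λ where (y , _ , e) → bump-≢ i y (sym e))
    (uniq-map (bump-mono i) π (uniq pp))
  bounded′ : ∀ v → v ∈ rho i j π → 1 ≤ v × v ≤ length (rho i j π)
  bounded′ v v∈ rewrite length-rho i j π with ∈-insertAt⁻ (j ∸ 1) i L v∈
  ... | inj₁ refl = 1≤i , i≤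
  ... | inj₂ v∈L with ∈-map⁻ (bump i) v∈L
  ... | y , y∈ , refl with bounded pp y y∈ | bump-cases i y
  ... | 1≤y , y≤ | inj₁ (_ , e) rewrite e = s≤s z≤n , s≤s y≤
  ... | 1≤y , y≤ | inj₂ (_ , e) rewrite e = 1≤y , m≤n⇒m≤1+n y≤
  complete′ : ∀ v → 1 ≤ v → v ≤ length (rho i j π) → v ∈ rho i j π
  complete′ v 1≤v v≤ rewrite length-rho i j π with <-cmp v i
  ... | tri≈ _ refl _ = ∈-insertAt (j ∸ 1) i L
  ... | tri< v<i _ _ = ∈-insertAt⁺ (j ∸ 1) i L
    (subst (_∈ L) (bump-< i v v<i) (∈-map⁺ (bump i) (complete pp v 1≤v (≤-pred (<-≤-trans v<i i≤)))))
  complete′ (suc v) 1≤v v≤ | tri> _ _ i<v = ∈-insertAt⁺ (j ∸ 1) i L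
    (subst (_∈ L) (bump-≥ i v (≤-pred i<v)) (∈-map⁺ (bump i) (complete pp v (≤-trans 1≤i (≤-pred i<v)) (≤-pred v≤))))

rho-last : ∀ i π → rho i (suc (length π)) π ≡ map (bump i) π ++ [ i ]
rho-last i π = subst (λ k → insertAt k i (map (bump i) π) ≡ map (bump i) π ++ [ i ])
  (length-map (bump i) π) (insertAt-length (map (bump i) π) i)

map-bump₁ : ∀ {π} → IsPerm π → map (bump 1) π ≡ map suc π
map-bump₁ {π} pp = map-cong-local (All.tabulate λ {x} x∈ → bump-≥ 1 x (perm-positive pp x x∈))

-- The avoidance classes are closed under the operators

data RectPat : Pat → Set where
  r2413 : RectPat P2413
  r2431 : RectPat P2431
  r4213 : RectPat P4213
  r4231 : RectPat P4231

data EvilPat : Pat → Set where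
  e2413 : EvilPat P2413
  e4132 : EvilPat P4132
  e4213 : EvilPat P4213
  e3214 : EvilPat P3214

avoidsRect-closed : ∀ {π π′} → (∀ {P} → RectPat P → ¬ Occurrence P π → ¬ Occurrence P π′) → AvoidsRect π → AvoidsRect π′
avoidsRect-closed close (a , b , c , d) = close r2413 a , close r2431 b , close r4213 c , close r4231 d

avoidsEvil-closed : ∀ {π π′} → (∀ {P} → EvilPat P → ¬ Occurrence P π → ¬ Occurrence P π′) → AvoidsEvil π → AvoidsEvil π′
avoidsEvil-closed close (a , b , c , d) = close e2413 a , close e4132 b , close e4213 c , close e3214 d

avoidsEvil-¬occurrence : ∀ {π P} → AvoidsEvil π → EvilPat P → ¬ Occurrence P π
avoidsEvil-¬occurrence (a , _ , _ , _) e2413 = a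
avoidsEvil-¬occurrence (_ , b , _ , _) e4132 = b
avoidsEvil-¬occurrence (_ , _ , c , _) e4213 = c
avoidsEvil-¬occurrence (_ , _ , _ , d) e3214 = d

avoidsEvil-map : ∀ {g} → StrictMono g → ∀ π → AvoidsEvil π → AvoidsEvil (map g π)
avoidsEvil-map {g} mono π = avoidsEvil-closed λ {P} _ ¬o o → ¬o (occurrence-map⁻ P mono π o)

All-map : ∀ {Q : ℕ → Set} (g : ℕ → ℕ) π → (∀ x → x ∈ π → Q (g x)) → All Q (map g π)
All-map g []      _ = []
All-map g (x ∷ π) h = h x (here refl) ∷ All-map g π (λ y y∈ → h y (there y∈))

All-L3 : ∀ {Q : ℕ → Set} {b c d} → All Q (L3 b c d) → Q b × Q c × Q d
All-L3 (Qb ∷ Qc ∷ Qd ∷ []) = Qb , Qc , Qd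

¬between : ∀ {a x} → a < x → x < suc a → ⊥
¬between a<x x<1+a = <⇒≱ a<x (≤-pred x<1+a)

first-not-least : ∀ P {a b c d} → Matches P a b c d → b < a ⊎ c < a ⊎ d < a
first-not-least P2413 (x , y , z) = inj₂ (inj₁ x)
first-not-least P2431 (x , y , z) = inj₂ (inj₂ x)
first-not-least P4213 (x , y , z) = inj₂ (inj₂ z)
first-not-least P4231 (x , y , z) = inj₂ (inj₁ z)
first-not-least P4132 (x , y , z) = inj₂ (inj₁ z)
first-not-least P3214 (x , y , z) = inj₁ y

¬below-all-above : ∀ {v b c d} → All (v <_) (L3 b c d) → b < v ⊎ c < v ⊎ d < v → ⊥
¬below-all-above (x ∷ _ ∷ _ ∷ []) (inj₁ l)        = <-asym x l
¬below-all-above (_ ∷ y ∷ _ ∷ []) (inj₂ (inj₁ l)) = <-asym y l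
¬below-all-above (_ ∷ _ ∷ z ∷ []) (inj₂ (inj₂ l)) = <-asym z l

evil-last-not-least : ∀ {P} → EvilPat P → ∀ {a b c d} → Matches P a b c d → a < d ⊎ b < d ⊎ c < d
evil-last-not-least e2413 (x , y , z) = inj₁ y
evil-last-not-least e4132 (x , y , z) = inj₂ (inj₁ x)
evil-last-not-least e4213 (x , y , z) = inj₂ (inj₁ y)
evil-last-not-least e3214 (x , y , z) = inj₁ z

rect-second-not-least : ∀ {P} → RectPat P → ∀ {a b c d} → Matches P a b c d → c < b ⊎ d < b
rect-second-not-least r2413 (x , y , z) = inj₂ z
rect-second-not-least r2431 (x , y , z) = inj₁ z
rect-second-not-least r4213 (x , y , z) = inj₁ x
rect-second-not-least r4231 (x , y , z) = inj₂ x

rect-¬first-pred-second : ∀ {P} → RectPat P → ∀ {a c d} → Matches P a (suc a) c d → ⊥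
rect-¬first-pred-second r2413 (x , y , z) = ¬between y z
rect-¬first-pred-second r2431 (x , y , z) = ¬between y z
rect-¬first-pred-second r4213 (x , y , z) = <-asym (<-trans (n<1+n _) y) z
rect-¬first-pred-second r4231 (x , y , z) = <-asym (<-trans (n<1+n _) y) z

rect-¬first-succ-second : ∀ {P} → RectPat P → ∀ {b c d} → Matches P (suc b) b c d → ⊥
rect-¬first-succ-second r2413 (x , y , z) = <-asym (<-trans (n<1+n _) y) z
rect-¬first-succ-second r2431 (x , y , z) = <-asym (<-trans (n<1+n _) y) z
rect-¬first-succ-second r4213 (x , y , z) = ¬between y z
rect-¬first-succ-second r4231 (x , y , z) = ¬between y z

matches-raise-first : ∀ P {a b c d} → b ≢ suc a → c ≢ suc a → d ≢ suc a → Matches P a b c d → Matches P (suc a) b c d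
matches-raise-first P2413 _  _  nd (x , y , z) = m<n⇒m<1+n x , ≤∧≢⇒< y (nd ∘ sym) , z
matches-raise-first P2431 _  nc _  (x , y , z) = m<n⇒m<1+n x , ≤∧≢⇒< y (nc ∘ sym) , z
matches-raise-first P4213 _  _  _  (x , y , z) = x , y , m<n⇒m<1+n z
matches-raise-first P4231 _  _  _  (x , y , z) = x , y , m<n⇒m<1+n z
matches-raise-first P4132 _  _  _  (x , y , z) = x , y , m<n⇒m<1+n z
matches-raise-first P3214 _  _  nd (x , y , z) = x , m<n⇒m<1+n y , ≤∧≢⇒< z (nd ∘ sym)

matches-lower-first : ∀ P {a b c d} → b ≢ a → c ≢ a → d ≢ a → Matches P (suc a) b c d → Matches P a b c d
matches-lower-first P2413 _  nc _  (x , y , z) = ≤∧≢⇒< (≤-pred x) nc , <-trans (n<1+n _) y , z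
matches-lower-first P2431 _  _  nd (x , y , z) = ≤∧≢⇒< (≤-pred x) nd , <-trans (n<1+n _) y , z
matches-lower-first P4213 _  _  nd (x , y , z) = x , y , ≤∧≢⇒< (≤-pred z) nd
matches-lower-first P4231 _  nc _  (x , y , z) = x , y , ≤∧≢⇒< (≤-pred z) nc
matches-lower-first P4132 _  nc _  (x , y , z) = x , y , ≤∧≢⇒< (≤-pred z) nc
matches-lower-first P3214 nb _  _  (x , y , z) = x , ≤∧≢⇒< (≤-pred y) nb , <-trans (n<1+n _) z

map-bump₁-above-1 : ∀ {π} → IsPerm π → All (1 <_) (map (bump 1) π)
map-bump₁-above-1 {π} pp = All-map (bump 1) π λ x x∈ →
  subst (1 <_) (sym (bump-≥ 1 x (perm-positive pp x x∈))) (s≤s (perm-positive pp x x∈))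

-- ψ₁ and ψ_p: the new first entry 1 is the least value, but no pattern starts with its least value.
rho₁₁-avoids : ∀ P π → IsPerm π → ¬ Occurrence P π → ¬ Occurrence P (rho 1 1 π)
rho₁₁-avoids P π pp ¬o o with occurrence-∷ P o
... | inj₁ o′ = ¬o (occurrence-map⁻ P (bump-mono 1) π o′)
... | inj₂ (_ , _ , _ , sub , m) = ¬below-all-above (All-resp-⊆ sub (map-bump₁-above-1 pp)) (first-not-least P m)

-- ψ_r: the new last entry 1 is the least value, but no evil pattern ends with its least value.
append-one-avoids : ∀ {P} → EvilPat P → ∀ π → ¬ Occurrence P π → ¬ Occurrence P (map suc π ++ [ 1 ])
append-one-avoids {P} ep π ¬o o with occurrence-∷ʳ P (map suc π) o
... | inj₁ o′ = ¬o (occurrence-map⁻ P s≤s π o′)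
... | inj₂ (_ , _ , _ , sub , m) with All-L3 (All-resp-⊆ sub (All-map {Q = 0 <_} suc π (λ _ _ → s≤s z≤n))) | evil-last-not-least ep m
...   | x , _ , _ | inj₁ l        = ¬between x l
...   | _ , y , _ | inj₂ (inj₁ l) = ¬between y l
...   | _ , _ , z | inj₂ (inj₂ l) = ¬between z l

-- ψ₂: the new second entry 1 is the least value, which no rectangular pattern has in first or second position.
rho₁₂-avoids : ∀ {P} → RectPat P → ∀ x y rest → IsPerm (x ∷ y ∷ rest) →
  ¬ Occurrence P (x ∷ y ∷ rest) → ¬ Occurrence P (rho 1 2 (x ∷ y ∷ rest))
rho₁₂-avoids {P} rp x y rest pp ¬o o with occurrence-∷ P o
... | inj₂ (b , c , d , (_ ∷ʳ sub) , m) =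
  ¬o (occurrence-map⁻ P (bump-mono 1) (x ∷ y ∷ rest) (bump 1 x , b , c , d , refl ∷ sub , m))
... | inj₂ (b , c , d , (refl ∷ sub) , m) with All-resp-⊆ (_ ∷ʳ sub) (map-bump₁-above-1 pp) | rect-second-not-least rp m
...   | 1<c ∷ _ ∷ [] | inj₁ l = <-asym 1<c l
...   | _ ∷ 1<d ∷ [] | inj₂ l = <-asym 1<d l
rho₁₂-avoids {P} rp x y rest pp ¬o o | inj₁ o₁ with occurrence-∷ P o₁
... | inj₁ o₂ = ¬o (occurrence-map⁻ P (bump-mono 1) (x ∷ y ∷ rest) (occurrence-⊆ P (_ ∷ʳ ⊆-refl) o₂))
... | inj₂ (_ , _ , _ , sub , m) = ¬below-all-above (All-resp-⊆ (_ ∷ʳ sub) (map-bump₁-above-1 pp)) (first-not-least P m)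

map-bump-avoids-suc : ∀ x y rest → IsPerm (x ∷ y ∷ rest) → All (_≢ suc x) (map (bump x) (y ∷ rest))
map-bump-avoids-suc x y rest pp = All-map (bump x) (y ∷ rest) λ z z∈ e →
  proj₁ (uniq pp) (subst (_∈ y ∷ rest) (strictMono-injective (bump-mono x) (trans e (sym (bump-≥ x x ≤-refl)))) z∈)

map-bump-avoids : ∀ x rest → IsPerm (x ∷ rest) → All (_≢ x) (map (bump (suc x)) rest)
map-bump-avoids x rest pp = All-map (bump (suc x)) rest λ z z∈ e →
  proj₁ (uniq pp) (subst (_∈ rest) (strictMono-injective (bump-mono (suc x)) (trans e (sym (bump-< (suc x) x ≤-refl)))) z∈)

-- ψ_u inserts x just before x + 1: an occurrence using the new x either uses x + 1 as well,
-- impossible for a rectangular pattern, or may use x + 1 in its place.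
rho-head-avoids : ∀ {P} → RectPat P → ∀ x y rest → IsPerm (x ∷ y ∷ rest) →
  ¬ Occurrence P (x ∷ y ∷ rest) → ¬ Occurrence P (rho x 1 (x ∷ y ∷ rest))
rho-head-avoids {P} rp x y rest pp ¬o o₀ with occurrence-∷ P (subst (λ z → Occurrence P (x ∷ z ∷ map (bump x) (y ∷ rest))) (bump-≥ x x ≤-refl) o₀)
... | inj₁ o = ¬o (occurrence-map⁻ P (bump-mono x) (x ∷ y ∷ rest)
    (subst (λ z → Occurrence P (z ∷ map (bump x) (y ∷ rest))) (sym (bump-≥ x x ≤-refl)) o))
... | inj₂ (b , c , d , (refl ∷ sub) , m) = rect-¬first-pred-second rp m
... | inj₂ (b , c , d , (_ ∷ʳ sub) , m) with All-L3 (All-resp-⊆ sub (map-bump-avoids-suc x y rest pp))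
...   | nb , nc , nd = ¬o (occurrence-map⁻ P (bump-mono x) (x ∷ y ∷ rest)
    (subst (λ z → Occurrence P (z ∷ map (bump x) (y ∷ rest))) (sym (bump-≥ x x ≤-refl))
      (suc x , b , c , d , refl ∷ sub , matches-raise-first P nb nc nd m)))

-- ψ_d inserts x + 1 just before x, symmetrically.
rho-suc-head-avoids : ∀ {P} → RectPat P → ∀ x rest → IsPerm (x ∷ rest) →
  ¬ Occurrence P (x ∷ rest) → ¬ Occurrence P (rho (suc x) 1 (x ∷ rest))
rho-suc-head-avoids {P} rp x rest pp ¬o o₀ with occurrence-∷ P (subst (λ z → Occurrence P (suc x ∷ z ∷ map (bump (suc x)) rest)) (bump-< (suc x) x ≤-refl) o₀)
... | inj₁ o = ¬o (occurrence-map⁻ P (bump-mono (suc x)) (x ∷ rest)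
    (subst (λ z → Occurrence P (z ∷ map (bump (suc x)) rest)) (sym (bump-< (suc x) x ≤-refl)) o))
... | inj₂ (b , c , d , (refl ∷ sub) , m) = rect-¬first-succ-second rp m
... | inj₂ (b , c , d , (_ ∷ʳ sub) , m) with All-L3 (All-resp-⊆ sub (map-bump-avoids x rest pp))
...   | nb , nc , nd = ¬o (occurrence-map⁻ P (bump-mono (suc x)) (x ∷ rest)
    (subst (λ z → Occurrence P (z ∷ map (bump (suc x)) rest)) (sym (bump-< (suc x) x ≤-refl))
      (x , b , c , d , refl ∷ sub , matches-lower-first P nb nc nd m)))

block-prefix-above : ∀ mid t → IsPerm (mid ++ range′ 1 t) → ∀ x → x ∈ mid → t < x
block-prefix-above mid t pp x x∈ with t <? x
... | yes t<x = t<x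
... | no  t≮x = ⊥-elim (uniq-++-disjoint mid (range′ 1 t) (uniq pp) x∈
                  (∈-range′⁺ 1 t (perm-positive pp x (∈-++⁺ˡ x∈)) (s≤s (≮⇒≥ t≮x))))

-- ψ_s appends t + 1 to the final block 1 … t.  In an occurrence ending at t + 1 the smaller
-- entries lie in the increasing block, after all larger ones, which no evil pattern allows.
append-block-avoids : ∀ {P} → EvilPat P → ∀ mid t → IsPerm (mid ++ range′ 1 t) → ¬ Occurrence P (mid ++ range′ 1 t) →
  ¬ Occurrence P (map (bump (suc t)) (mid ++ range′ 1 t) ++ [ suc t ])
append-block-avoids {P} ep mid t pp ¬o o with occurrence-∷ʳ P (map (bump (suc t)) (mid ++ range′ 1 t)) o
... | inj₁ o′ = ¬o (occurrence-map⁻ P (bump-mono (suc t)) (mid ++ range′ 1 t) o′)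
... | inj₂ (a , b , c , sub₀ , m) = go ep m
  where
  M = map (bump (suc t)) mid
  sub : L3 a b c ⊆ M ++ range′ 1 t
  sub = subst (L3 a b c ⊆_) (trans (map-++ (bump (suc t)) mid (range′ 1 t))
          (cong (M ++_) (map-bump-range′ (suc t) 1 t ≤-refl))) sub₀
  M-large : All (λ z → ¬ (z < suc t)) M
  M-large = All-map (bump (suc t)) mid λ x x∈ l → <-asym l
    (subst (suc t <_) (sym (bump-≥ (suc t) x (block-prefix-above mid t pp x x∈))) (s≤s (block-prefix-above mid t pp x x∈)))
  in-block : ∀ {z} → z ∈ range′ 1 t → z < suc t
  in-block z∈ = proj₂ (∈-range′⁻ 1 t z∈)
  go : EvilPat P → Matches P a b c (suc t) → ⊥
  go e2413 (x , y , z) = <-asym z (in-block (to∈ (∷ˡ⁻ (⊆-skipˡ-head M (range′ 1 t) M-large y sub))))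
  go e4132 (x , y , z) = <-asym y (in-block (to∈ (∷ˡ⁻ (⊆-skipˡ-head M (range′ 1 t) M-large x (pick³₂₃ sub)))))
  go e4213 (x , y , z) = <-asym x (range′-increasing 1 t b c (⊆-skipˡ-head M (range′ 1 t) M-large y (pick³₂₃ sub)))
  go e3214 (x , y , z) = <-asym y (range′-increasing 1 t a b (⊆-skipˡ-head M (range′ 1 t) M-large z (pick³₁₂ sub)))

nonIdentity⇒≢range′ : ∀ {π} → NonIdentity π → π ≢ range′ 1 (length π)
nonIdentity⇒≢range′ {π} ni e = ni (trans e (sym (range≡range′ 1 (length π))))

≢range′⇒nonIdentity : ∀ {π} → π ≢ range′ 1 (length π) → NonIdentity π
≢range′⇒nonIdentity {π} ne e = ne (trans e (range≡range′ 1 (length π)))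

range′-nonIdentity : ∀ {π n} → π ≡ range′ 1 n → NonIdentity π → ⊥
range′-nonIdentity {π} {n} e ni = nonIdentity⇒≢range′ ni (trans e (cong (range′ 1) (sym (trans (cong length e) (length-range′ 1 n)))))

head≢1⇒nonIdentity : ∀ h T → h ≢ 1 → NonIdentity (h ∷ T)
head≢1⇒nonIdentity h T h≢1 = ≢range′⇒nonIdentity λ e → h≢1 (∷-injectiveˡ e)

rho₁₁-nonIdentity : ∀ π → IsPerm π → NonIdentity π → NonIdentity (rho 1 1 π)
rho₁₁-nonIdentity π pp ni = ≢range′⇒nonIdentity λ e → nonIdentity⇒≢range′ ni (map-injective suc-injective (begin
  map suc π                         ≡⟨ map-bump₁ pp ⟨
  map (bump 1) π                    ≡⟨ ∷-injectiveʳ (trans e (cong (range′ 1 ∘ suc) (length-map (bump 1) π))) ⟩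
  range′ 2 (length π)               ≡⟨ map-suc-range′ 1 (length π) ⟨
  map suc (range′ 1 (length π))     ∎))
  where open ≡-Reasoning

range′-∷ʳ-injective : ∀ {L v} n → L ++ [ v ] ≡ range′ 1 (suc n) → L ≡ range′ 1 n × v ≡ suc n
range′-∷ʳ-injective {L} n e = ∷ʳ-injective L (range′ 1 n) (trans e (range′-∷ʳ 1 n))

length-++-range′ : ∀ mid t → length (mid ++ range′ 1 t) ≡ length mid + t
length-++-range′ mid t = trans (length-++ mid) (cong (length mid +_) (length-range′ 1 t))

short-block⇒empty-prefix : ∀ mid t → length (mid ++ range′ 1 t) ≡ t → mid ≡ []
short-block⇒empty-prefix []      t _ = refl
short-block⇒empty-prefix (x ∷ mid) t e = ⊥-elim (<-irrefl (sym e) (s≤s (≤-trans (m≤n+m t (length mid))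
  (≤-reflexive (sym (length-++-range′ mid t))))))

rho-append-length : ∀ i π → length (map (bump i) π ++ [ i ]) ≡ suc (length π)
rho-append-length i π = trans (length-++ (map (bump i) π)) (trans (+-comm _ 1) (cong suc (length-map (bump i) π)))

append-one-nonIdentity : ∀ π → 1 ≤ length π → NonIdentity (map suc π ++ [ 1 ])
append-one-nonIdentity π 1≤n = ≢range′⇒nonIdentity λ e →
  <-irrefl (proj₂ (range′-∷ʳ-injective (length π) (trans e (cong (range′ 1) (trans (length-++ (map suc π))
    (trans (+-comm _ 1) (cong suc (length-map suc π)))))))) (s≤s 1≤n)

append-block-nonIdentity : ∀ π mid t → π ≡ mid ++ range′ 1 t → NonIdentity π →
  NonIdentity (map (bump (suc t)) π ++ [ suc t ])
append-block-nonIdentity π mid t π≡ ni = ≢range′⇒nonIdentity λ e →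
  let t≡n  = suc-injective (proj₂ (range′-∷ʳ-injective (length π) (trans e (cong (range′ 1) (rho-append-length (suc t) π)))))
      mid≡ = short-block⇒empty-prefix mid t (trans (cong length (sym π≡)) (sym t≡n))
  in range′-nonIdentity (trans π≡ (cong (_++ range′ 1 t) mid≡)) ni

EndsInBlock : List ℕ → Set
EndsInBlock π = Σ (List ℕ) λ mid → Σ ℕ λ t → 1 ≤ t × π ≡ mid ++ range′ 1 t

1∈block : ∀ mid t → 1 ≤ t → 1 ∈ mid ++ range′ 1 t
1∈block mid (suc t) _ = ∈-++⁺ʳ mid (here refl)

identity-block : ∀ n mid t → 1 ≤ t → range′ 1 (suc n) ≡ mid ++ range′ 1 t → mid ≡ [] × t ≡ suc n
identity-block n mid (suc t) _ e
  with range′-∷ʳ-injective n (sym (trans e (trans (cong (mid ++_) (range′-∷ʳ 1 t)) (sym (++-assoc mid (range′ 1 t) [ suc t ])))))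
... | prefix≡ , refl = short-block⇒empty-prefix mid t (trans (cong length prefix≡) (length-range′ 1 n)) , refl

rho-extends-identity : ∀ m → rho (suc m) (suc (length (range′ 1 m))) (range′ 1 m) ≡ range′ 1 (suc m)
rho-extends-identity m = begin
  rho (suc m) (suc (length (range′ 1 m))) (range′ 1 m)  ≡⟨ rho-last (suc m) (range′ 1 m) ⟩
  map (bump (suc m)) (range′ 1 m) ++ [ suc m ]          ≡⟨ cong (_++ [ suc m ]) (map-bump-range′ (suc m) 1 m ≤-refl) ⟩
  range′ 1 m ++ [ suc m ]                               ≡⟨ range′-∷ʳ 1 m ⟨
  range′ 1 (suc m)                                      ∎
  where open ≡-Reasoning

rho-extends-block : ∀ π mid t → π ≡ mid ++ range′ 1 t →
  rho (suc t) (suc (length π)) π ≡ map (bump (suc t)) mid ++ range′ 1 (suc t)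
rho-extends-block π mid t π≡ = begin
  rho (suc t) (suc (length π)) π                                     ≡⟨ rho-last (suc t) π ⟩
  map (bump (suc t)) π ++ [ suc t ]                                  ≡⟨ cong (λ z → map (bump (suc t)) z ++ [ suc t ]) π≡ ⟩
  map (bump (suc t)) (mid ++ range′ 1 t) ++ [ suc t ]                ≡⟨ cong (_++ [ suc t ]) (map-++ (bump (suc t)) mid (range′ 1 t)) ⟩
  (map (bump (suc t)) mid ++ map (bump (suc t)) (range′ 1 t)) ++ [ suc t ]
      ≡⟨ cong (λ z → (map (bump (suc t)) mid ++ z) ++ [ suc t ]) (map-bump-range′ (suc t) 1 t ≤-refl) ⟩
  (map (bump (suc t)) mid ++ range′ 1 t) ++ [ suc t ]                ≡⟨ ++-assoc (map (bump (suc t)) mid) (range′ 1 t) [ suc t ] ⟩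
  map (bump (suc t)) mid ++ range′ 1 t ++ [ suc t ]                  ≡⟨ cong (map (bump (suc t)) mid ++_) (range′-∷ʳ 1 t) ⟨
  map (bump (suc t)) mid ++ range′ 1 (suc t)                         ∎
  where open ≡-Reasoning

endsInBlock-∷ : ∀ h T mid t → h ∷ T ≡ mid ++ range′ 1 t → h ∷ T ≡ range′ 1 t ⊎ Σ (List ℕ) λ mid′ → T ≡ mid′ ++ range′ 1 t
endsInBlock-∷ h T []        t e = inj₁ e
endsInBlock-∷ h T (x ∷ mid) t e = inj₂ (mid , ∷-injectiveʳ e)

range′-head : ∀ {h T} k → h ∷ T ≡ range′ 1 k → h ≡ 1
range′-head (suc k) e = ∷-injectiveˡ e

rho₁₁-¬endsInBlock : ∀ π → IsPerm π → NonIdentity π → ¬ EndsInBlock (rho 1 1 π)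
rho₁₁-¬endsInBlock π pp ni (mid , t , 1≤t , e) with endsInBlock-∷ 1 (map (bump 1) π) mid t e
... | inj₁ e′ = range′-nonIdentity e′ (rho₁₁-nonIdentity π pp ni)
... | inj₂ (mid′ , e′) with ∈-map⁻ (bump 1) (subst (1 ∈_) (sym e′) (1∈block mid′ t 1≤t))
...   | y , _ , e″ = bump-≢ 1 y (sym e″)

map-++-split : ∀ (g : ℕ → ℕ) π X Y → map g π ≡ X ++ Y → Σ (List ℕ) λ X₀ → Σ (List ℕ) λ Y₀ → π ≡ X₀ ++ Y₀ × map g Y₀ ≡ Y
map-++-split g π       []      Y e = [] , π , refl , e
map-++-split g (x ∷ π) (z ∷ X) Y e with map-++-split g π X Y (∷-injectiveʳ e)
... | X₀ , Y₀ , e₁ , e₂ = x ∷ X₀ , Y₀ , cong (x ∷_) e₁ , e₂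

map-bump-fixes-small : ∀ t Y Z → map (bump (suc t)) Y ≡ Z → All (_≤ t) Z → Y ≡ Z
map-bump-fixes-small t []      []      e _ = refl
map-bump-fixes-small t (y ∷ Y) (z ∷ Z) e (z≤t ∷ Z≤t) with bump-cases (suc t) y
... | inj₁ (t<y , ey) = ⊥-elim (<⇒≱ (<-≤-trans t<y (n≤1+n y)) (subst (_≤ t) (trans (sym (∷-injectiveˡ e)) ey) z≤t))
... | inj₂ (_ , ey)  = cong₂ _∷_ (trans (sym ey) (∷-injectiveˡ e)) (map-bump-fixes-small t Y Z (∷-injectiveʳ e) Z≤t)

IsSandwiched : List ℕ → Set
IsSandwiched π = Σ ℕ λ a → Σ ℕ λ b → Σ (List ℕ) λ mid → Sandwiched a b mid π

-- A final block 1 … t′ of the result cannot contain t + 1, so t′ ≤ t and π would be (0, t′)-sandwiched.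
rhoq-¬endsInBlock : ∀ π t → 1 ≤ t → ¬ IsSandwiched π → ¬ EndsInBlock (suc t ∷ map (bump (suc t)) π)
rhoq-¬endsInBlock π t 1≤t ¬sw (mid , t′ , 1≤t′ , e) with endsInBlock-∷ (suc t) (map (bump (suc t)) π) mid t′ e
... | inj₁ e′ = <-irrefl (sym (range′-head t′ e′)) (s≤s 1≤t)
... | inj₂ (mid′ , e′) with map-++-split (bump (suc t)) π mid′ (range′ 1 t′) e′
... | X₀ , Y₀ , π≡ , Y₀↦ with t′ ≤? t
...   | yes t′≤t = ¬sw (0 , t′ , X₀ , 1≤t′ , trans π≡ (cong (X₀ ++_) (trans
          (map-bump-fixes-small t Y₀ (range′ 1 t′) Y₀↦ (All.tabulate λ z∈ → ≤-trans (≤-pred (proj₂ (∈-range′⁻ 1 t′ z∈))) t′≤t))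
          (sym (range≡range′ 1 t′)))))
...   | no t′≰t with ∈-map⁻ (bump (suc t)) (subst (suc t ∈_) (sym Y₀↦) (∈-range′⁺ 1 t′ (s≤s z≤n) (s≤s (≰⇒> t′≰t))))
...     | y , _ , e″ = bump-≢ (suc t) y (sym e″)

Descent : List ℕ → ℕ → Set
Descent π i = suc i ∷ i ∷ [] ⊆ π

descent⇒occursAfter : ∀ π i → Descent π i → OccursAfter π i
descent⇒occursAfter π i sub with ⊆-∷-split π sub
... | A , B , π≡ , sub′ with ⊆-∷-split B sub′
...   | C , D , B≡ , _ = A , C , D , trans π≡ (cong (λ z → A ++ suc i ∷ z) B≡)

occursAfter⇒descent : ∀ π i → OccursAfter π i → Descent π i
occursAfter⇒descent π i (xs , ys , zs , refl) = ++⁺ˡ xs (refl ∷ ++⁺ˡ ys (refl ∷ minimum zs))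

LeastDescent : List ℕ → ℕ → Set
LeastDescent π t = 1 ≤ t × Descent π t × (∀ j → 1 ≤ j → j < t → ¬ Descent π j)

isLeastDescent⇔ : ∀ π t → (IsLeastDescent π t → LeastDescent π t) × (LeastDescent π t → IsLeastDescent π t)
isLeastDescent⇔ π t =
  (λ (1≤t , oa , least) → 1≤t , occursAfter⇒descent π t oa , λ i 1≤i i<t d → least i 1≤i i<t (descent⇒occursAfter π i d)) ,
  (λ (1≤t , d , least) → 1≤t , descent⇒occursAfter π t d , λ i 1≤i i<t oa → least i 1≤i i<t (occursAfter⇒descent π i oa))

least-descent-below : ∀ π k → (Σ ℕ λ t → t < k × LeastDescent π t) ⊎ (∀ j → 1 ≤ j → j < k → ¬ Descent π j)
least-descent-below π zero = inj₂ λ _ _ ()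
least-descent-below π (suc k) with least-descent-below π k
... | inj₁ (t , t<k , ld) = inj₁ (t , m<n⇒m<1+n t<k , ld)
... | inj₂ none with k ≟ 0 | suc k ∷ k ∷ [] ⊆? π
...   | yes refl | _     = inj₂ λ { j 1≤j (s≤s j≤0) → ⊥-elim (<⇒≱ 1≤j j≤0) }
...   | no k≢0   | yes d = inj₁ (k , n<1+n k , n≢0⇒n>0 k≢0 , d , none)
...   | no k≢0   | no ¬d = inj₂ λ j 1≤j j<1+k → case m≤n⇒m<n∨m≡n (≤-pred j<1+k) of λ where
                                (inj₁ j<k)  → none j 1≤j j<k
                                (inj₂ refl) → ¬d

ascent : ∀ {π} → IsPerm π → ∀ i → 1 ≤ i → suc i ≤ length π → ¬ Descent π i → i ∷ suc i ∷ [] ⊆ π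
ascent {π} pp i 1≤i i<n ¬desc with either-order π (λ e → <-irrefl e (n<1+n i))
  (complete pp i 1≤i (<⇒≤ i<n)) (complete pp (suc i) (s≤s z≤n) i<n)
... | inj₁ sub = sub
... | inj₂ sub = ⊥-elim (¬desc sub)

-- Without descents, the values 1 … n appear in increasing order, which forces the identity.
no-descent⇒identity : ∀ π → IsPerm π → (∀ j → 1 ≤ j → j < length π → ¬ Descent π j) → π ≡ range′ 1 (length π)
no-descent⇒identity π pp none = sym (≋⇒≡ (to-≋ (length-range′ 1 (length π)) (increasing (length π) ≤-refl)))
  where
  increasing : ∀ k → k ≤ length π → range′ 1 k ⊆ π
  increasing zero          _   = minimum π
  increasing (suc zero)    k≤n = from∈ (complete pp 1 ≤-refl k≤n)
  increasing (suc (suc k)) k≤n = subst (_⊆ π) glued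
    (⊆-glue (range′ 1 k) (suc (suc k) ∷ []) π (uniq pp)
      (subst (_⊆ π) (range′-∷ʳ 1 k) (increasing (suc k) (<⇒≤ k≤n))) (ascent pp (suc k) (s≤s z≤n) k≤n (none (suc k) (s≤s z≤n) k≤n)))
    where
    glued : range′ 1 k ++ suc k ∷ suc (suc k) ∷ [] ≡ range′ 1 (suc (suc k))
    glued = sym (trans (range′-∷ʳ 1 (suc k)) (trans (cong (_++ [ suc (suc k) ]) (range′-∷ʳ 1 k))
              (++-assoc (range′ 1 k) [ suc k ] [ suc (suc k) ])))

least-descent : ∀ π → IsPerm π → NonIdentity π → Σ ℕ λ t → LeastDescent π t
least-descent π pp ni with least-descent-below π (length π)
... | inj₁ (t , _ , ld) = t , ld
... | inj₂ none         = ⊥-elim (range′-nonIdentity (no-descent⇒identity π pp none) ni)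

length-range : ∀ s k → length (range s k) ≡ k
length-range s k = trans (cong length (range≡range′ s k)) (length-range′ s k)

take-++ : ∀ (A B : List ℕ) → take (length A) (A ++ B) ≡ A
take-++ []      B = refl
take-++ (x ∷ A) B = cong (x ∷_) (take-++ A B)

drop-++ : ∀ (A B : List ℕ) → drop (length A) (A ++ B) ≡ B
drop-++ []      B = refl
drop-++ (x ∷ A) B = drop-++ A B

sandwiched-ab? : ∀ π a b → Dec (Σ (List ℕ) λ mid → Sandwiched a b mid π)
sandwiched-ab? π a zero = no λ { (_ , () , _) }
sandwiched-ab? π a (suc b) with ≡-dec _≟_ (take a π) (range 1 a)
... | no prefix≢ = no λ { (mid , _ , e) → prefix≢ (trans (cong (take a) e)
        (subst (λ k → take k (range 1 a ++ mid ++ range (suc a) (suc b)) ≡ range 1 a) (length-range 1 a)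
          (take-++ (range 1 a) (mid ++ range (suc a) (suc b))))) }
... | yes prefix≡ with ≡-dec _≟_ (drop (length (drop a π) ∸ suc b) (drop a π)) (range (suc a) (suc b))
...   | yes suffix≡ = yes (take k rest , s≤s z≤n , π≡)
  where
  rest = drop a π
  k    = length rest ∸ suc b
  π≡ : π ≡ range 1 a ++ take k rest ++ range (suc a) (suc b)
  π≡ = trans (sym (take++drop≡id a π))
         (cong₂ _++_ prefix≡ (trans (sym (take++drop≡id k rest)) (cong (take k rest ++_) suffix≡)))
...   | no suffix≢ = no λ { (mid , _ , e) → suffix≢ (suffix mid e) }
  where
  suffix : ∀ mid → π ≡ range 1 a ++ mid ++ range (suc a) (suc b) →
    drop (length (drop a π) ∸ suc b) (drop a π) ≡ range (suc a) (suc b)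
  suffix mid e = trans (cong₂ drop k≡ rest≡) (drop-++ mid (range (suc a) (suc b)))
    where
    rest≡ : drop a π ≡ mid ++ range (suc a) (suc b)
    rest≡ = trans (cong (drop a) e) (subst (λ k → drop k (range 1 a ++ mid ++ range (suc a) (suc b)) ≡ mid ++ range (suc a) (suc b))
              (length-range 1 a) (drop-++ (range 1 a) (mid ++ range (suc a) (suc b))))
    k≡ : length (drop a π) ∸ suc b ≡ length mid
    k≡ = trans (cong (λ z → length z ∸ suc b) rest≡)
           (trans (cong (_∸ suc b) (trans (length-++ mid) (cong (length mid +_) (length-range (suc a) (suc b)))))
             (m+n∸n≡m (length mid) (suc b)))

-- a and b are bounded by the length of π, so the search is finite.
sandwiched? : ∀ π → Dec (IsSandwiched π)
sandwiched? π with anyUpTo? (λ a → anyUpTo? (sandwiched-ab? π a) (suc (length π))) (suc (length π))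
... | yes (a , _ , b , _ , mid , sw) = yes (a , b , mid , sw)
... | no ¬sw = no λ { (a , b , mid , 1≤b , e) → ¬sw (a , s≤s (a≤ {a} {b} mid e) , b , s≤s (b≤ {a} {b} mid e) , mid , 1≤b , e) }
  where
  length≡ : ∀ {a b} mid → π ≡ range 1 a ++ mid ++ range (suc a) b → length π ≡ a + (length mid + b)
  length≡ {a} {b} mid e = trans (cong length e) (trans (length-++ (range 1 a))
    (cong₂ _+_ (length-range 1 a) (trans (length-++ mid) (cong (length mid +_) (length-range (suc a) b)))))
  a≤ : ∀ {a b} mid → π ≡ range 1 a ++ mid ++ range (suc a) b → a ≤ length π
  a≤ {a} {b} mid e = subst (a ≤_) (sym (length≡ {a} {b} mid e)) (m≤m+n a _)
  b≤ : ∀ {a b} mid → π ≡ range 1 a ++ mid ++ range (suc a) b → b ≤ length π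
  b≤ {a} {b} mid e = subst (b ≤_) (sym (length≡ {a} {b} mid e)) (≤-trans (m≤n+m b (length mid)) (m≤n+m _ a))

-- ψ_q when π is not sandwiched: with t the least descent, the values 1 … t occur in
-- increasing order in π, so a new first entry t + 1 can only create an evil pattern
-- through a pair of values ≤ t in decreasing order, or (for 2413) through t + 2.

module QNonSandwiched (π : List ℕ) (t : ℕ) (pp : IsPerm π) (1≤t : 1 ≤ t) (desc : Descent π t)
                     (least : ∀ i → 1 ≤ i → i < t → ¬ Descent π i) (av : AvoidsEvil π) where

  t<n : suc t ≤ length π
  t<n = proj₂ (bounded pp (suc t) (to∈ desc))

  ordered : ∀ f e → 1 ≤ e → e < f → f ≤ t → e ∷ f ∷ [] ⊆ π
  ordered (suc f) e 1≤e (s≤s e≤f) f<t with m≤n⇒m<n∨m≡n e≤f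
  ... | inj₂ refl = ascent pp e 1≤e (≤-trans f<t (<⇒≤ t<n)) (least e 1≤e f<t)
  ... | inj₁ e<f  = pick³₁₃ (⊆-glue (e ∷ []) (suc f ∷ []) π (uniq pp)
                      (ordered f e 1≤e e<f (<⇒≤ f<t))
                      (ascent pp f (≤-trans 1≤e (<⇒≤ e<f)) (≤-trans f<t (<⇒≤ t<n)) (least f (≤-trans 1≤e (<⇒≤ e<f)) f<t)))

  v = suc t
  L = map (bump v) π

  uniqL : Uniq L
  uniqL = uniq-map (bump-mono v) π (uniq pp)

  avL : AvoidsEvil L
  avL = avoidsEvil-map (bump-mono v) π av

  positiveL : ∀ x → x ∈ L → 1 ≤ x
  positiveL x x∈ with ∈-map⁻ (bump v) x∈
  ... | y , y∈ , refl with bump-cases v y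
  ... | inj₁ (_ , e) rewrite e = s≤s z≤n
  ... | inj₂ (_ , e) rewrite e = perm-positive pp y y∈

  descL : suc v ∷ t ∷ [] ⊆ L
  descL = subst₂ (λ a b → a ∷ b ∷ [] ⊆ L) (bump-≥ v v ≤-refl) (bump-< v t ≤-refl) (⊆-map⁺ (bump v) desc)

  orderedL : ∀ e f → 1 ≤ e → e < f → f ≤ t → e ∷ f ∷ [] ⊆ L
  orderedL e f 1≤e e<f f≤t = subst₂ (λ a b → a ∷ b ∷ [] ⊆ L)
    (bump-< v e (s≤s (≤-trans (<⇒≤ e<f) f≤t))) (bump-< v f (s≤s f≤t)) (⊆-map⁺ (bump v) (ordered f e 1≤e e<f f≤t))

  ¬small-inversion : ∀ {e f} → f ∷ e ∷ [] ⊆ L → e < f → f < v → ⊥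
  ¬small-inversion {e} {f} sub e<f f<v =
    ¬both-orders L uniqL sub (orderedL e f (positiveL e (to∈ (∷ˡ⁻ sub))) e<f (≤-pred f<v))

  suc-v<d : ∀ {x d} → v < d → suc v ∷ x ∷ [] ⊆ L → x ∷ d ∷ [] ⊆ L → suc v < d
  suc-v<d v<d s₁ s₂ = ≤∧≢⇒< v<d (λ { refl → ¬both-orders L uniqL s₁ s₂ })

  ¬new-first : ∀ {P} → EvilPat P → ∀ {b c d} → L3 b c d ⊆ L → Matches P v b c d → ⊥
  ¬new-first e4132 sub (x , y , z) = ¬small-inversion (pick³₂₃ sub) y z
  ¬new-first e4213 sub (x , y , z) = ¬small-inversion (pick³₁₂ sub) x (<-trans y z)
  ¬new-first e3214 sub (x , y , z) = ¬small-inversion (pick³₁₂ sub) x y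
  ¬new-first e2413 {b} {c} {d} sub (c<v , v<d , d<b) with either-order L b≢w (to∈ descL) (to∈ sub)
    where
    b≢w : suc v ≢ b
    b≢w refl = ¬between v<d d<b
  ... | inj₁ wb = avoidsEvil-¬occurrence avL e2413 (suc v , b , c , d , ⊆-glue (suc v ∷ []) (c ∷ d ∷ []) L uniqL wb sub ,
                    m<n⇒m<1+n c<v , suc-v<d v<d wb (pick³₁₃ sub) , d<b)
  ... | inj₂ bw with c ≟ t
  ...   | yes refl = avoidsEvil-¬occurrence avL e4213 (b , suc v , c , d ,
            ⊆-glue (b ∷ suc v ∷ []) (d ∷ []) L uniqL (⊆-glue (b ∷ []) (c ∷ []) L uniqL bw descL) (pick³₂₃ sub) ,
            m<n⇒m<1+n c<v , suc-v<d v<d descL (pick³₂₃ sub) , d<b)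
  ...   | no c≢t with either-order L (λ e → <-irrefl (sym e) (<-trans c<v (n<1+n v))) (to∈ descL) (to∈ (∷ˡ⁻ sub))
  ...     | inj₁ wc = avoidsEvil-¬occurrence avL e4213 (b , suc v , c , d ,
              ⊆-glue (b ∷ suc v ∷ []) (d ∷ []) L uniqL (⊆-glue (b ∷ []) (c ∷ []) L uniqL bw wc) (pick³₂₃ sub) ,
              m<n⇒m<1+n c<v , suc-v<d v<d wc (pick³₂₃ sub) , d<b)
  ...     | inj₂ cw = avoidsEvil-¬occurrence avL e4132 (b , c , suc v , t ,
              ⊆-glue (b ∷ c ∷ []) (t ∷ []) L uniqL (⊆-glue (b ∷ []) (suc v ∷ []) L uniqL (pick³₁₂ sub) cw) descL ,
              ≤∧≢⇒< (≤-pred c<v) c≢t , <-trans (n<1+n t) (n<1+n v) ,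
              ≤∧≢⇒< (<-trans v<d d<b) (λ { refl → ¬between v<d d<b }))

  output-avoidsEvil : AvoidsEvil (v ∷ L)
  output-avoidsEvil = avoidsEvil-closed (λ {P} ep ¬o o → case occurrence-∷ P o of λ where
      (inj₁ o′) → ¬o o′
      (inj₂ (_ , _ , _ , sub , m)) → ¬new-first ep sub m)
    avL

-- In the result K+1 · 1 … a+1 · mid+1 · a+2 … K
-- (K = a + b) the entries are small (≤ K, increasing) or large (> K + 1, a copy of mid), and no
-- small entry lies between two large ones; the new first entry K + 1 separates the two kinds.

module QSandwiched (a b′ : ℕ) (mid : List ℕ) (pp : IsPerm (range′ 1 a ++ mid ++ range′ (suc a) (suc b′)))
                   (av : AvoidsEvil (range′ 1 a ++ mid ++ range′ (suc a) (suc b′))) where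

  K  = a + suc b′
  π₀ = range′ 1 a ++ mid ++ range′ (suc a) (suc b′)
  R₁ = range′ 1 (suc a)
  M  = map suc mid
  R₂ = range′ (suc (suc a)) b′
  τ  = R₁ ++ M ++ R₂

  K≡ : K ≡ suc (a + b′)
  K≡ = +-suc a b′

  mid-above : ∀ x → x ∈ mid → K < x
  mid-above x x∈ = ≰⇒> ¬≤K
    where
    x∈π₀ : x ∈ π₀
    x∈π₀ = ∈-++⁺ʳ (range′ 1 a) (∈-++⁺ˡ x∈)
    ∉prefix : x ≤ a → ⊥
    ∉prefix x≤a = uniq-++-disjoint (range′ 1 a) _ (uniq pp) (∈-range′⁺ 1 a (perm-positive pp x x∈π₀) (s≤s x≤a)) (∈-++⁺ˡ x∈)
    ¬≤K : x ≤ K → ⊥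
    ¬≤K x≤K with a <? x
    ... | yes a<x = uniq-++-disjoint mid _ (uniq-++⁻ʳ (range′ 1 a) _ (uniq pp)) x∈ (∈-range′⁺ (suc a) (suc b′) a<x (s≤s x≤K))
    ... | no ¬a<x = ∉prefix (≮⇒≥ ¬a<x)

  Small Large : ℕ → Set
  Small z = z ≤ K
  Large z = suc K < z

  R₁-small : ∀ z → z ∈ R₁ → Small z
  R₁-small z z∈ = ≤-trans (≤-pred (proj₂ (∈-range′⁻ 1 (suc a) z∈))) (subst (suc a ≤_) (sym K≡) (s≤s (m≤m+n a b′)))

  R₂-small : ∀ z → z ∈ R₂ → Small z
  R₂-small z z∈ = subst (z ≤_) (sym K≡) (≤-pred (proj₂ (∈-range′⁻ (suc (suc a)) b′ z∈)))

  M-large : ∀ z → z ∈ M → Large z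
  M-large z z∈ with ∈-map⁻ suc z∈
  ... | y , y∈ , refl = s≤s (mid-above y y∈)

  ¬small-large : ∀ {z} → Small z → Large z → ⊥
  ¬small-large s l = <⇒≱ l (m≤n⇒m≤1+n s)

  classify : ∀ z → z ∈ τ → Small z ⊎ Large z
  classify z z∈ with ∈-++⁻ R₁ z∈
  ... | inj₁ z∈R₁ = inj₁ (R₁-small z z∈R₁)
  ... | inj₂ z∈′ with ∈-++⁻ M z∈′
  ...   | inj₁ z∈M  = inj₂ (M-large z z∈M)
  ...   | inj₂ z∈R₂ = inj₁ (R₂-small z z∈R₂)

  R₁-¬large : All (¬_ ∘ Large) R₁
  R₁-¬large = All.tabulate λ {z} z∈ → ¬small-large (R₁-small z z∈)
  R₂-¬large : All (¬_ ∘ Large) R₂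
  R₂-¬large = All.tabulate λ {z} z∈ → ¬small-large (R₂-small z z∈)
  M-¬small : All (¬_ ∘ Small) M
  M-¬small = All.tabulate λ {z} z∈ s → ¬small-large s (M-large z z∈)

  small-increasing : ∀ {e f} → e ∷ f ∷ [] ⊆ τ → Small e → Small f → e < f
  small-increasing {e} {f} sub se sf = range′-increasing 1 (suc a + b′) e f
    (subst (e ∷ f ∷ [] ⊆_) (range′-++ 1 (suc a) b′) (⊆-skip-middle R₁ M R₂ (se ∷ sf ∷ []) M-¬small sub))

  ¬large-small-large : ∀ {e f g} → L3 e f g ⊆ τ → Large e → Small f → Large g → ⊥
  ¬large-small-large sub le sf lg = ¬small-large
    (R₂-small _ (to∈ (∷ˡ⁻ (⊆-skipˡ-head M R₂ M-¬small sf (∷ˡ⁻ (⊆-skipˡ-head R₁ (M ++ R₂) R₁-¬large le sub)))))) lg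

  ¬all-large : ∀ {P} → EvilPat P → ∀ {w x y z} → L4 w x y z ⊆ τ →
    Large w → Large x → Large y → Large z → Matches P w x y z → ⊥
  ¬all-large {P} ep sub lw lx ly lz m = avoidsEvil-¬occurrence av ep
    (occurrence-⊆ P (++⁺ˡ (range′ 1 a) (++⁺ʳ _ ⊆-refl))
      (occurrence-map⁻ P s≤s mid
        (_ , _ , _ , _ , ⊆-within-middle R₁ M R₂ (lw ∷ lx ∷ ly ∷ lz ∷ []) R₁-¬large R₂-¬large sub , m)))

  ¬inside : ∀ {P} → EvilPat P → ∀ {w x y z} → L4 w x y z ⊆ τ → Matches P w x y z → ⊥
  ¬inside e2413 {w} sub (yw , wz , zx) with classify w (to∈ sub)
  ... | inj₁ sw = <-asym yw (small-increasing (pick₁₃ sub) sw (<⇒≤ (≤-trans yw sw)))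
  ... | inj₂ lw with classify _ (to∈ (∷ˡ⁻ (∷ˡ⁻ sub)))
  ...   | inj₁ sy = ¬large-small-large (pick₂₃₄ sub) (<-trans lw (<-trans wz zx)) sy (<-trans lw wz)
  ...   | inj₂ ly = ¬all-large e2413 sub lw (<-trans lw (<-trans wz zx)) ly (<-trans lw wz) (yw , wz , zx)
  ¬inside e4132 {w} sub (xz , zy , yw) with classify w (to∈ sub)
  ... | inj₁ sw = <-asym (<-trans xz (<-trans zy yw)) (small-increasing (pick₁₂ sub) sw (<⇒≤ (≤-trans (<-trans xz (<-trans zy yw)) sw)))
  ... | inj₂ lw with classify _ (to∈ (∷ˡ⁻ sub))
  ...   | inj₂ lx = ¬all-large e4132 sub lw lx (<-trans lx (<-trans xz zy)) (<-trans lx xz) (xz , zy , yw)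
  ...   | inj₁ sx with classify _ (to∈ (∷ˡ⁻ (∷ˡ⁻ sub)))
  ...     | inj₁ sy = <-asym zy (small-increasing (pick₃₄ sub) sy (<⇒≤ (≤-trans zy sy)))
  ...     | inj₂ ly = ¬large-small-large (pick₁₂₃ sub) lw sx ly
  ¬inside e4213 {w} sub (yx , xz , zw) with classify w (to∈ sub)
  ... | inj₁ sw = <-asym (<-trans xz zw) (small-increasing (pick₁₂ sub) sw (<⇒≤ (≤-trans (<-trans xz zw) sw)))
  ... | inj₂ lw with classify _ (to∈ (∷ˡ⁻ sub))
  ...   | inj₁ sx = <-asym yx (small-increasing (pick₂₃ sub) sx (<⇒≤ (≤-trans yx sx)))
  ...   | inj₂ lx with classify _ (to∈ (∷ˡ⁻ (∷ˡ⁻ sub)))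
  ...     | inj₂ ly = ¬all-large e4213 sub lw lx ly (<-trans lx xz) (yx , xz , zw)
  ...     | inj₁ sy = ¬large-small-large (pick₂₃₄ sub) lx sy (<-trans lx xz)
  ¬inside e3214 {w} sub (yx , xw , wz) with classify w (to∈ sub)
  ... | inj₁ sw = <-asym xw (small-increasing (pick₁₂ sub) sw (<⇒≤ (≤-trans xw sw)))
  ... | inj₂ lw with classify _ (to∈ (∷ˡ⁻ sub))
  ...   | inj₁ sx = <-asym yx (small-increasing (pick₂₃ sub) sx (<⇒≤ (≤-trans yx sx)))
  ...   | inj₂ lx with classify _ (to∈ (∷ˡ⁻ (∷ˡ⁻ sub)))
  ...     | inj₂ ly = ¬all-large e3214 sub lw lx ly (<-trans lw wz) (yx , xw , wz)
  ...     | inj₁ sy = ¬large-small-large (pick₂₃₄ sub) lx sy (<-trans lw wz)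

  ¬new-first : ∀ {P} → EvilPat P → ∀ {x y z} → L3 x y z ⊆ τ → Matches P (suc K) x y z → ⊥
  ¬new-first e2413 sub (y< , <z , z<x) = ¬large-small-large sub (<-trans <z z<x) (≤-pred y<) <z
  ¬new-first e4132 sub (x<z , z<y , y<) = <-asym z<y (small-increasing (pick³₂₃ sub) (≤-pred y<) (≤-pred (<-trans z<y y<)))
  ¬new-first e4213 sub (y<x , x<z , z<) =
    <-asym y<x (small-increasing (pick³₁₂ sub) (≤-pred (<-trans x<z z<)) (≤-pred (<-trans y<x (<-trans x<z z<))))
  ¬new-first e3214 sub (y<x , x< , <z) = <-asym y<x (small-increasing (pick³₁₂ sub) (≤-pred x<) (≤-pred (<-trans y<x x<)))

  output-avoidsEvil : AvoidsEvil (suc K ∷ τ)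
  output-avoidsEvil = (¬occ e2413 , ¬occ e4132 , ¬occ e4213 , ¬occ e3214)
    where
    ¬occ : ∀ {P} → EvilPat P → ¬ Occurrence P (suc K ∷ τ)
    ¬occ {P} ep o with occurrence-∷ P o
    ... | inj₁ (_ , _ , _ , _ , sub , m) = ¬inside ep sub m
    ... | inj₂ (_ , _ , _ , sub , m)     = ¬new-first ep sub m

  length-π₀ : length π₀ ≡ a + (length mid + suc b′)
  length-π₀ = trans (length-++ (range′ 1 a)) (cong₂ _+_ (length-range′ 1 a)
    (trans (length-++ mid) (cong (length mid +_) (length-range′ (suc a) (suc b′)))))

  length-τ : length τ ≡ length π₀
  length-τ = begin
    length τ                                 ≡⟨ length-++ R₁ ⟩
    length R₁ + length (M ++ R₂)             ≡⟨ cong₂ _+_ (length-range′ 1 (suc a)) (length-++ M) ⟩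
    suc a + (length M + length R₂)           ≡⟨ cong (λ z → suc a + (z + length R₂)) (length-map suc mid) ⟩
    suc a + (length mid + length R₂)         ≡⟨ cong (λ z → suc a + (length mid + z)) (length-range′ (suc (suc a)) b′) ⟩
    suc a + (length mid + b′)                ≡⟨ +-suc a (length mid + b′) ⟨
    a + suc (length mid + b′)                ≡⟨ cong (a +_) (+-suc (length mid) b′) ⟨
    a + (length mid + suc b′)                ≡⟨ length-π₀ ⟨
    length π₀                                ∎
    where open ≡-Reasoning

  K≤n : K ≤ length π₀
  K≤n = subst (K ≤_) (sym length-π₀) (+-monoʳ-≤ a (m≤n+m (suc b′) (length mid)))

  mid⊆π₀ : mid ⊆ π₀
  mid⊆π₀ = ++⁺ˡ (range′ 1 a) (++⁺ʳ _ ⊆-refl)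

  output-isPerm : IsPerm (suc K ∷ τ)
  output-isPerm = isPerm (K+1∉ , uniqτ) bounded′ complete′
    where
    K+1∉ : suc K ∉ τ
    K+1∉ K+1∈ with classify (suc K) K+1∈
    ... | inj₁ small = <-irrefl refl small
    ... | inj₂ large = <-irrefl refl large
    uniqτ : Uniq τ
    uniqτ = uniq-++ R₁ (M ++ R₂) (uniq-range′ 1 (suc a))
      (uniq-++ M R₂ (uniq-map s≤s mid (uniq-⊆ mid⊆π₀ (uniq pp))) (uniq-range′ (suc (suc a)) b′)
        (λ x x∈M x∈R₂ → ¬small-large (R₂-small x x∈R₂) (M-large x x∈M)))
      λ x x∈R₁ x∈ → case ∈-++⁻ M x∈ of λ where
        (inj₁ x∈M)  → ¬small-large (R₁-small x x∈R₁) (M-large x x∈M)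
        (inj₂ x∈R₂) → <-irrefl refl (<-≤-trans (proj₂ (∈-range′⁻ 1 (suc a) x∈R₁)) (proj₁ (∈-range′⁻ (suc (suc a)) b′ x∈R₂)))
    bounded′ : ∀ v → v ∈ suc K ∷ τ → 1 ≤ v × v ≤ length (suc K ∷ τ)
    bounded′ v v∈ rewrite length-τ with v∈
    ... | here refl = s≤s z≤n , s≤s K≤n
    ... | there v∈τ with ∈-++⁻ R₁ v∈τ
    ...   | inj₁ v∈R₁ = proj₁ (∈-range′⁻ 1 (suc a) v∈R₁) , m≤n⇒m≤1+n (≤-trans (R₁-small v v∈R₁) K≤n)
    ...   | inj₂ v∈′ with ∈-++⁻ M v∈′
    ...     | inj₂ v∈R₂ = ≤-trans (s≤s z≤n) (proj₁ (∈-range′⁻ (suc (suc a)) b′ v∈R₂)) , m≤n⇒m≤1+n (≤-trans (R₂-small v v∈R₂) K≤n)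
    ...     | inj₁ v∈M with ∈-map⁻ suc v∈M
    ...       | y , y∈ , refl = s≤s z≤n , s≤s (proj₂ (bounded pp y (to∈ (⊆-trans (from∈ y∈) mid⊆π₀))))
    complete′ : ∀ v → 1 ≤ v → v ≤ length (suc K ∷ τ) → v ∈ suc K ∷ τ
    complete′ v 1≤v v≤ rewrite length-τ with v ≤? suc a
    ... | yes v≤a+1 = there (∈-++⁺ˡ (∈-range′⁺ 1 (suc a) 1≤v (s≤s v≤a+1)))
    ... | no v≰a+1 with <-cmp v (suc K)
    ...   | tri< v<K+1 _ _ = there (∈-++⁺ʳ R₁ (∈-++⁺ʳ M (∈-range′⁺ (suc (suc a)) b′ (≰⇒> v≰a+1) (subst (v <_) (cong suc K≡) v<K+1))))
    ...   | tri≈ _ refl _  = here refl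
    complete′ (suc w) 1≤v v≤ | no v≰a+1 | tri> _ _ K+1<v
      with ∈-++⁻ (range′ 1 a) (complete pp w (≤-trans (s≤s z≤n) (≤-pred K+1<v)) (≤-pred v≤))
    ... | inj₁ w∈ = ⊥-elim (<⇒≱ (proj₂ (∈-range′⁻ 1 a w∈)) (≤-trans (s≤s (m≤m+n a (suc b′))) (≤-pred K+1<v)))
    ... | inj₂ w∈ with ∈-++⁻ mid w∈
    ...   | inj₁ w∈mid = there (∈-++⁺ʳ R₁ (∈-++⁺ˡ (∈-map⁺ suc w∈mid)))
    ...   | inj₂ w∈R  = ⊥-elim (<⇒≱ (proj₂ (∈-range′⁻ (suc a) (suc b′) w∈R)) (≤-pred K+1<v))

  -- The block would have to be all of τ (it contains 1, the head of τ), yet K + 1 is missing from τ.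
  output-¬endsInBlock : NonIdentity π₀ → ¬ EndsInBlock (suc K ∷ τ)
  output-¬endsInBlock ni (mid′ , t , 1≤t , e) with endsInBlock-∷ (suc K) τ mid′ t e
  ... | inj₁ e′ = <-irrefl (sym (range′-head t e′)) (s≤s (subst (1 ≤_) (sym K≡) (s≤s z≤n)))
  ... | inj₂ ([] , τ≡) = proj₁ (uniq output-isPerm)
        (subst (suc K ∈_) (sym τ≡) (∈-range′⁺ 1 t (s≤s z≤n) (s≤s (subst (suc K ≤_) n≡t K<n))))
    where
    n≡t : length π₀ ≡ t
    n≡t = trans (sym length-τ) (trans (cong length τ≡) (length-range′ 1 t))
    mid≢[] : mid ≢ []
    mid≢[] refl = range′-nonIdentity (trans (range′-++ 1 a (suc b′)) (cong (range′ 1) (sym length-π₀))) ni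
    nonempty : ∀ (xs : List ℕ) → xs ≢ [] → 1 ≤ length xs
    nonempty []      xs≢[] = ⊥-elim (xs≢[] refl)
    nonempty (_ ∷ _) _     = s≤s z≤n
    K<n : suc K ≤ length π₀
    K<n = subst (suc K ≤_) (sym length-π₀) (subst (_≤ a + (length mid + suc b′)) (+-suc a (suc b′))
            (+-monoʳ-≤ a (+-monoˡ-≤ (suc b′) (nonempty mid mid≢[]))))
  ... | inj₂ (_ ∷ mid″ , τ≡) = proj₁ (proj₂ (uniq output-isPerm)) (subst (1 ∈_) (sym (∷-injectiveʳ τ≡)) (1∈block mid″ t 1≤t))

QOutput : List ℕ → Set
QOutput π′ = IsPerm π′ × AvoidsEvil π′ × NonIdentity π′ × ¬ EndsInBlock π′

sandwiched-input≡ : ∀ a b′ mid → range 1 a ++ mid ++ range (suc a) (suc b′) ≡ range′ 1 a ++ mid ++ range′ (suc a) (suc b′)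
sandwiched-input≡ a b′ mid = cong₂ _++_ (range≡range′ 1 a) (cong (mid ++_) (range≡range′ (suc a) (suc b′)))

sandwiched-output≡ : ∀ a b′ mid → suc (a + suc b′) ∷ range 1 (suc a) ++ map suc mid ++ range (2 + a) b′
                                 ≡ suc (a + suc b′) ∷ range′ 1 (suc a) ++ map suc mid ++ range′ (2 + a) b′
sandwiched-output≡ a b′ mid = cong (suc (a + suc b′) ∷_)
  (cong₂ _++_ (range≡range′ 1 (suc a)) (cong (map suc mid ++_) (range≡range′ (2 + a) b′)))

sandwiched-q-output : ∀ {π} a b′ mid → π ≡ range 1 a ++ mid ++ range (suc a) (suc b′) →
  IsPerm π → AvoidsEvil π → NonIdentity π → QOutput (suc (a + suc b′) ∷ range 1 (suc a) ++ map suc mid ++ range (2 + a) b′)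
sandwiched-q-output a b′ mid π≡ pp av ni = subst QOutput (sym (sandwiched-output≡ a b′ mid))
  ( S.output-isPerm , S.output-avoidsEvil
  , head≢1⇒nonIdentity _ _ (λ e → <-irrefl (sym e) (s≤s (subst (1 ≤_) (sym (+-suc a b′)) (s≤s z≤n))))
  , S.output-¬endsInBlock (subst NonIdentity π≡′ ni))
  where
  π≡′ = trans π≡ (sandwiched-input≡ a b′ mid)
  module S = QSandwiched a b′ mid (subst IsPerm π≡′ pp) (subst AvoidsEvil π≡′ av)

nonSandwiched-q-output : ∀ π t → IsPerm π → AvoidsEvil π → NonIdentity π → ¬ IsSandwiched π → LeastDescent π t →
  QOutput (suc t ∷ map (bump (suc t)) π)
nonSandwiched-q-output π t pp av ni ¬sw ld@(1≤t , desc , least) =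
  rho-isPerm (suc t) 1 π pp (s≤s z≤n) (m≤n⇒m≤1+n (proj₂ (bounded pp (suc t) (to∈ desc)))) ,
  QNonSandwiched.output-avoidsEvil π t pp 1≤t desc least av ,
  head≢1⇒nonIdentity _ _ (λ e → <-irrefl (sym e) (s≤s 1≤t)) ,
  rhoq-¬endsInBlock π t 1≤t ¬sw

q-output : ∀ {π π′} → StepE q π π′ → IsPerm π → QOutput π′
q-output (stqSand {b = zero} _ _ (() , _))
q-output (stqSand {a = a} {b = suc b′} {mid = mid} ev ni (_ , π≡)) pp =
  sandwiched-q-output a b′ mid π≡ pp (evilAvoiding⇒avoidsEvil ev) ni
q-output (stqNot {π} {t} ev ni ¬sw lt) pp =
  nonSandwiched-q-output π t pp (evilAvoiding⇒avoidsEvil ev) ni ¬sw (proj₁ (isLeastDescent⇔ π t) lt)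

q-exists : ∀ π → IsPerm π → AvoidsEvil π → NonIdentity π → Σ (List ℕ) (StepE q π)
q-exists π pp av ni with sandwiched? π
... | yes (a , b , mid , sw) = _ , stqSand {a = a} {b = b} {mid = mid} (avoidsEvil⇒evilAvoiding av) ni sw
... | no ¬sw with least-descent π pp ni
...   | t , ld = _ , stqNot (avoidsEvil⇒evilAvoiding av) ni ¬sw (proj₂ (isLeastDescent⇔ π t) ld)

-- Runs of the evil-avoiding operators: a finite automaton

-- A word is read from its last letter, the first operator applied.
runFrom : {C S : Set} → (C → S → Maybe S) → Maybe S → List C → Maybe S
runFrom δ m = foldr (λ c m′ → m′ >>= δ c) m

open Defs using (p; r; s)

data EvilState : Set where
  ev-empty ev-identity ev-block ev-other : EvilState

evilStep : EL → EvilState → Maybe EvilState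
evilStep s ev-empty    = just ev-identity
evilStep s ev-identity = just ev-identity
evilStep s ev-block    = just ev-block
evilStep s ev-other    = nothing
evilStep r ev-empty    = nothing
evilStep r _           = just ev-block
evilStep p ev-block    = just ev-other
evilStep p ev-other    = just ev-other
evilStep p _           = nothing
evilStep q ev-block    = just ev-other
evilStep q ev-other    = just ev-other
evilStep q _           = nothing

evilRun : List EL → Maybe EvilState
evilRun = runFrom evilStep (just ev-empty)

EvilShape : EvilState → List ℕ → Set
EvilShape ev-empty    π = π ≡ []
EvilShape ev-identity π = Σ ℕ λ n → π ≡ range′ 1 (suc n)
EvilShape ev-block    π = NonIdentity π × EndsInBlock π
EvilShape ev-other    π = NonIdentity π × ¬ EndsInBlock π

EvilInv : EvilState → List ℕ → Set
EvilInv st π = IsPerm π × AvoidsEvil π × EvilShape st π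

¬occurrence-[] : ∀ P → ¬ Occurrence P []
¬occurrence-[] P (_ , _ , _ , _ , () , _)

evilInv-empty : EvilInv ev-empty []
evilInv-empty = range′-isPerm 0 , (¬occurrence-[] P2413 , ¬occurrence-[] P4132 , ¬occurrence-[] P4213 , ¬occurrence-[] P3214) , refl

avoidsEvil-identity : ∀ k → AvoidsEvil (range′ 1 k)
avoidsEvil-identity k =
  (λ (_ , _ , _ , _ , sub , x , y , z) → <-asym (range′-increasing 1 k _ _ (pick₂₃ sub)) (<-trans x (<-trans y z))) ,
  (λ (_ , _ , _ , _ , sub , x , y , z) → <-asym (range′-increasing 1 k _ _ (pick₁₂ sub)) (<-trans x (<-trans y z))) ,
  (λ (_ , _ , _ , _ , sub , x , y , z) → <-asym (range′-increasing 1 k _ _ (pick₁₂ sub)) (<-trans y z)) ,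
  (λ (_ , _ , _ , _ , sub , x , y , z) → <-asym (range′-increasing 1 k _ _ (pick₁₂ sub)) y)

evilInv-nonempty : ∀ {st π} → EvilInv st π → st ≢ ev-empty → Σ ℕ λ x → Σ (List ℕ) λ rest → π ≡ x ∷ rest
evilInv-nonempty {ev-empty}    _                   ne = ⊥-elim (ne refl)
evilInv-nonempty {ev-identity} (_ , _ , n , refl) _ = 1 , range′ 2 n , refl
evilInv-nonempty {ev-block}    {[]}    (_ , _ , ni , _) _ = ⊥-elim (ni refl)
evilInv-nonempty {ev-block}    {x ∷ π} _                _ = x , π , refl
evilInv-nonempty {ev-other}    {[]}    (_ , _ , ni , _) _ = ⊥-elim (ni refl)
evilInv-nonempty {ev-other}    {x ∷ π} _                _ = x , π , refl

p-output : ∀ π → IsPerm π → AvoidsEvil π → NonIdentity π → EvilInv ev-other (rho 1 1 π)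
p-output π pp av ni = rho-isPerm 1 1 π pp ≤-refl (s≤s z≤n) , avoidsEvil-closed (λ {P} _ → rho₁₁-avoids P π pp) av ,
  rho₁₁-nonIdentity π pp ni , rho₁₁-¬endsInBlock π pp ni

r-output : ∀ π → IsPerm π → AvoidsEvil π → 1 ≤ length π → EvilInv ev-block (map suc π ++ [ 1 ])
r-output π pp av 1≤n =
  subst IsPerm (trans (rho-last 1 π) (cong (_++ [ 1 ]) (map-bump₁ pp))) (rho-isPerm 1 (suc (length π)) π pp ≤-refl (s≤s z≤n)) ,
  avoidsEvil-closed (λ ep → append-one-avoids ep π) av ,
  append-one-nonIdentity π 1≤n , (map suc π , 1 , ≤-refl , refl)

s-block-output : ∀ mid t → IsPerm (mid ++ range′ 1 t) → AvoidsEvil (mid ++ range′ 1 t) → NonIdentity (mid ++ range′ 1 t) →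
  EvilInv ev-block (rho (suc t) (suc (length (mid ++ range′ 1 t))) (mid ++ range′ 1 t))
s-block-output mid t pp av ni =
  rho-isPerm (suc t) (suc (length π)) π pp (s≤s z≤n) (s≤s (subst (t ≤_) (sym (length-++-range′ mid t)) (m≤n+m t (length mid)))) ,
  subst AvoidsEvil (sym (rho-last (suc t) π)) (avoidsEvil-closed (λ ep → append-block-avoids ep mid t pp) av) ,
  subst NonIdentity (sym (rho-last (suc t) π)) (append-block-nonIdentity π mid t refl ni) ,
  (map (bump (suc t)) mid , suc t , s≤s z≤n , rho-extends-block π mid t refl)
  where
  π = mid ++ range′ 1 t

s-identity-output : ∀ n → EvilInv ev-identity (rho (suc (suc n)) (suc (length (range′ 1 (suc n)))) (range′ 1 (suc n)))
s-identity-output n = subst (λ π → EvilInv ev-identity π) (sym (rho-extends-identity (suc n)))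
  (range′-isPerm (suc (suc n)) , avoidsEvil-identity (suc (suc n)) , suc n , refl)

block⇒range′ : ∀ {π mid t} → π ≡ mid ++ range 1 t → π ≡ mid ++ range′ 1 t
block⇒range′ {mid = mid} {t} e = trans e (cong (mid ++_) (range≡range′ 1 t))

evil-step-preserves : ∀ {c π π′} st → StepE c π π′ → EvilInv st π → Σ EvilState λ st′ → evilStep c st ≡ just st′ × EvilInv st′ π′
evil-step-preserves ev-empty    (stp _ ni)       (_ , _ , refl)           = ⊥-elim (ni refl)
evil-step-preserves ev-identity (stp _ ni)       (_ , _ , n , refl)       = ⊥-elim (range′-nonIdentity refl ni)
evil-step-preserves ev-block    (stp {π} _ ni)   (pp , av , _)            = ev-other , refl , p-output π pp av ni
evil-step-preserves ev-other    (stp {π} _ ni)   (pp , av , _)            = ev-other , refl , p-output π pp av ni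
evil-step-preserves ev-empty    (stqSand _ ni _) (_ , _ , refl)           = ⊥-elim (ni refl)
evil-step-preserves ev-identity (stqSand _ ni _) (_ , _ , n , refl)       = ⊥-elim (range′-nonIdentity refl ni)
evil-step-preserves ev-empty    (stqNot _ ni _ _) (_ , _ , refl)          = ⊥-elim (ni refl)
evil-step-preserves ev-identity (stqNot _ ni _ _) (_ , _ , n , refl)      = ⊥-elim (range′-nonIdentity refl ni)
evil-step-preserves ev-block    st@(stqSand _ _ _)  (pp , _) = ev-other , refl , q-output st pp
evil-step-preserves ev-other    st@(stqSand _ _ _)  (pp , _) = ev-other , refl , q-output st pp
evil-step-preserves ev-block    st@(stqNot _ _ _ _) (pp , _) = ev-other , refl , q-output st pp
evil-step-preserves ev-other    st@(stqNot _ _ _ _) (pp , _) = ev-other , refl , q-output st pp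
evil-step-preserves ev-empty    (str _)          (_ , _ , ())
evil-step-preserves ev-identity (str {x} {rest} _) (pp , av , _)          = ev-block , refl , r-output (x ∷ rest) pp av (s≤s z≤n)
evil-step-preserves ev-block    (str {x} {rest} _) (pp , av , _)          = ev-block , refl , r-output (x ∷ rest) pp av (s≤s z≤n)
evil-step-preserves ev-other    (str {x} {rest} _) (pp , av , _)          = ev-block , refl , r-output (x ∷ rest) pp av (s≤s z≤n)
evil-step-preserves ev-empty    stsEmpty         _                        = ev-identity , refl , range′-isPerm 1 , avoidsEvil-identity 1 , 0 , refl
evil-step-preserves ev-identity stsEmpty         (_ , _ , _ , ())
evil-step-preserves ev-block    stsEmpty         (_ , _ , ni , _)         = ⊥-elim (ni refl)
evil-step-preserves ev-other    stsEmpty         (_ , _ , ni , _)         = ⊥-elim (ni refl)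
evil-step-preserves ev-empty    (sts {mid = mid} {t} _ 1≤t π≡) (_ , _ , refl)
  with subst (1 ∈_) (sym (block⇒range′ {mid = mid} π≡)) (1∈block mid t 1≤t)
... | ()
evil-step-preserves ev-identity (sts {mid = mid} {t} _ 1≤t π≡) (_ , _ , n , refl)
  with identity-block n mid t 1≤t (block⇒range′ {mid = mid} π≡)
... | refl , refl = ev-identity , refl , s-identity-output n
evil-step-preserves ev-block    (sts {mid = mid} {t} _ 1≤t π≡) (pp , av , ni , _) with block⇒range′ {mid = mid} π≡
... | refl = ev-block , refl , s-block-output mid t pp av ni
evil-step-preserves ev-other    (sts {mid = mid} {t} _ 1≤t π≡) (_ , _ , _ , ¬b) = ⊥-elim (¬b (mid , t , 1≤t , block⇒range′ {mid = mid} π≡))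

evil-step-exists : ∀ c st {st′} π → evilStep c st ≡ just st′ → EvilInv st π → Σ (List ℕ) (StepE c π)
evil-step-exists s ev-empty    .[] _ (_ , _ , refl)     = _ , stsEmpty
evil-step-exists s ev-identity π  _ (_ , _ , n , refl) =
  _ , sts {mid = []} (avoidsEvil⇒evilAvoiding (avoidsEvil-identity (suc n))) (s≤s z≤n) (sym (range≡range′ 1 (suc n)))
evil-step-exists s ev-block    π  _ (_ , av , _ , mid , t , 1≤t , π≡) =
  _ , sts (avoidsEvil⇒evilAvoiding av) 1≤t (trans π≡ (cong (mid ++_) (sym (range≡range′ 1 t))))
evil-step-exists s ev-other    π  () _
evil-step-exists r ev-empty    π  () _
evil-step-exists r st          π  δ≡ inv@(_ , av , _) with evilInv-nonempty inv (λ { refl → case δ≡ of λ () })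
... | x , rest , refl = _ , str (avoidsEvil⇒evilAvoiding av)
evil-step-exists p ev-block    π  _ (_ , av , ni , _) = _ , stp (avoidsEvil⇒evilAvoiding av) ni
evil-step-exists p ev-other    π  _ (_ , av , ni , _) = _ , stp (avoidsEvil⇒evilAvoiding av) ni
evil-step-exists q ev-block    π  _ (pp , av , ni , _) = q-exists π pp av ni
evil-step-exists q ev-other    π  _ (pp , av , ni , _) = q-exists π pp av ni

evil-run-sound : ∀ {w π} → RunE w π → Σ EvilState λ st → evilRun w ≡ just st × EvilInv st π
evil-run-sound runNil = ev-empty , refl , evilInv-empty
evil-run-sound (runCons {c = c} run step) with evil-run-sound run
... | st , run≡ , inv with evil-step-preserves st step inv
...   | st′ , δ≡ , inv′ = st′ , trans (cong (_>>= evilStep c) run≡) δ≡ , inv′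

evil-run-complete : ∀ w {st} → evilRun w ≡ just st → Σ (List ℕ) λ π → RunE w π × EvilInv st π
evil-run-complete []      refl = [] , runNil , evilInv-empty
evil-run-complete (c ∷ w) run≡ with evilRun w in w≡
... | just st₀ with evil-run-complete w w≡
...   | π , run , inv with evil-step-exists c st₀ π run≡ inv
...     | π′ , step with evil-step-preserves st₀ step inv
...       | st′ , δ≡ , inv′ with just-injective (trans (sym δ≡) run≡)
...         | refl = π′ , runCons run step , inv′

-- Runs of the rectangular operators: a finite automaton

open Defs using (one; two; u; d)

data RectState : Set where
  rc-empty rc-one rc-other : RectState

rectStep : RL → RectState → Maybe RectState
rectStep one _        = just rc-one
rectStep two rc-other = just rc-other
rectStep two _        = nothing
rectStep u   rc-other = just rc-other
rectStep u   _        = nothing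
rectStep d   rc-empty = nothing
rectStep d   _        = just rc-other

rectRun : List RL → Maybe RectState
rectRun = runFrom rectStep (just rc-empty)

RectShape : RectState → List ℕ → Set
RectShape rc-empty π = π ≡ []
RectShape rc-one   π = Σ (List ℕ) λ rest → π ≡ 1 ∷ rest
RectShape rc-other π = Σ ℕ λ h → Σ ℕ λ y → Σ (List ℕ) λ rest → π ≡ h ∷ y ∷ rest × 2 ≤ h

RectInv : RectState → List ℕ → Set
RectInv st π = IsPerm π × AvoidsRect π × RectShape st π

rectInv-empty : RectInv rc-empty []
rectInv-empty = range′-isPerm 0 , (¬occurrence-[] P2413 , ¬occurrence-[] P2431 , ¬occurrence-[] P4213 , ¬occurrence-[] P4231) , refl

2≤bump₁ : ∀ x → 1 ≤ x → 2 ≤ bump 1 x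
2≤bump₁ x 1≤x = subst (2 ≤_) (sym (bump-≥ 1 x 1≤x)) (s≤s 1≤x)

head≤length : ∀ {x rest} → IsPerm (x ∷ rest) → x ≤ length (x ∷ rest)
head≤length pp = proj₂ (bounded pp _ (here refl))

rect-step-preserves : ∀ {c π π′} st → StepR c π π′ → RectInv st π → Σ RectState λ st′ → rectStep c st ≡ just st′ × RectInv st′ π′
rect-step-preserves st (st1 {π} _) (pp , av , _) =
  rc-one , refl , rho-isPerm 1 1 π pp ≤-refl (s≤s z≤n) , avoidsRect-closed (λ {P} _ → rho₁₁-avoids P π pp) av , _ , refl
rect-step-preserves rc-empty (st2 _ _)     (_ , _ , ())
rect-step-preserves rc-one   (st2 _ x≢1)   (_ , _ , _ , refl) = ⊥-elim (x≢1 refl)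
rect-step-preserves rc-other (st2 {x} {y} {rest} _ _) (pp , av , _ , _ , _ , refl , 2≤x) =
  rc-other , refl , rho-isPerm 1 2 (x ∷ y ∷ rest) pp ≤-refl (s≤s z≤n) ,
  avoidsRect-closed (λ rp → rho₁₂-avoids rp x y rest pp) av , bump 1 x , 1 , _ , refl , 2≤bump₁ x (<⇒≤ 2≤x)
rect-step-preserves rc-empty (stu _ _)     (_ , _ , ())
rect-step-preserves rc-one   (stu _ x≢1)   (_ , _ , _ , refl) = ⊥-elim (x≢1 refl)
rect-step-preserves rc-other (stu {x} {y} {rest} _ _) (pp , av , _ , _ , _ , refl , 2≤x) =
  rc-other , refl , rho-isPerm x 1 (x ∷ y ∷ rest) pp (<⇒≤ 2≤x) (m≤n⇒m≤1+n (head≤length pp)) ,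
  avoidsRect-closed (λ rp → rho-head-avoids rp x y rest pp) av , x , bump x x , _ , refl , 2≤x
rect-step-preserves rc-empty (std _)       (_ , _ , ())
rect-step-preserves rc-one   (std {rest = rest} _) (pp , av , _ , refl) =
  rc-other , refl , rho-isPerm 2 1 (1 ∷ rest) pp (s≤s z≤n) (s≤s (head≤length pp)) ,
  avoidsRect-closed (λ rp → rho-suc-head-avoids rp 1 rest pp) av , 2 , bump 2 1 , _ , refl , ≤-refl
rect-step-preserves rc-other (std {x} {rest} _) (pp , av , _ , _ , _ , refl , 2≤x) =
  rc-other , refl , rho-isPerm (suc x) 1 (x ∷ rest) pp (s≤s z≤n) (s≤s (head≤length pp)) ,
  avoidsRect-closed (λ rp → rho-suc-head-avoids rp x rest pp) av , suc x , bump (suc x) x , _ , refl , m≤n⇒m≤1+n 2≤x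

rect-step-exists : ∀ c st {st′} π → rectStep c st ≡ just st′ → RectInv st π → Σ (List ℕ) (StepR c π)
rect-step-exists one st       π _ (_ , av , _) = _ , st1 (avoidsRect⇒rectangular av)
rect-step-exists two rc-other π _ (_ , av , _ , _ , _ , refl , 2≤h) = _ , st2 (avoidsRect⇒rectangular av) (λ { refl → <⇒≱ 2≤h ≤-refl })
rect-step-exists u   rc-other π _ (_ , av , _ , _ , _ , refl , 2≤h) = _ , stu (avoidsRect⇒rectangular av) (λ { refl → <⇒≱ 2≤h ≤-refl })
rect-step-exists d   rc-one   π _ (_ , av , _ , refl)               = _ , std (avoidsRect⇒rectangular av)
rect-step-exists d   rc-other π _ (_ , av , _ , _ , _ , refl , _)   = _ , std (avoidsRect⇒rectangular av)
rect-step-exists two rc-empty π () _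
rect-step-exists two rc-one   π () _
rect-step-exists u   rc-empty π () _
rect-step-exists u   rc-one   π () _
rect-step-exists d   rc-empty π () _

rect-run-sound : ∀ {w π} → RunR w π → Σ RectState λ st → rectRun w ≡ just st × RectInv st π
rect-run-sound runNil = rc-empty , refl , rectInv-empty
rect-run-sound (runCons {c = c} run step) with rect-run-sound run
... | st , run≡ , inv with rect-step-preserves st step inv
...   | st′ , δ≡ , inv′ = st′ , trans (cong (_>>= rectStep c) run≡) δ≡ , inv′

rect-run-complete : ∀ w {st} → rectRun w ≡ just st → Σ (List ℕ) λ π → RunR w π × RectInv st π
rect-run-complete []      refl = [] , runNil , rectInv-empty
rect-run-complete (c ∷ w) run≡ with rectRun w in w≡
... | just st₀ with rect-run-complete w w≡
...   | π , run , inv with rect-step-exists c st₀ π run≡ inv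
...     | π′ , step with rect-step-preserves st₀ step inv
...       | st′ , δ≡ , inv′ with just-injective (trans (sym δ≡) run≡)
...         | refl = π′ , runCons run step , inv′

data LastView {A : Set} (a : A) : List A → Set where
  none : ∀ {v} → All (_≢ a) v → LastView a v
  last : ∀ x {y} → All (_≢ a) y → LastView a (x ++ a ∷ y)

lastView : ∀ {A : Set} {a : A} → (∀ c → Dec (c ≡ a)) → ∀ v → LastView a v
lastView a? []      = none []
lastView a? (c ∷ v) with lastView a? v
... | last x ny = last (c ∷ x) ny
... | none nv with a? c
...   | yes refl = last [] nv
...   | no  c≢a  = none (c≢a ∷ nv)

≡r? : ∀ c → Dec (c ≡ r)
≡r? p = no λ ()
≡r? q = no λ ()
≡r? r = yes refl
≡r? s = no λ ()

splitLastR-none : ∀ {v} → All (_≢ r) v → splitLastR v ≡ nothing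
splitLastR-none {[]}    []          = refl
splitLastR-none {c ∷ v} (c≢r ∷ nv) rewrite splitLastR-none nv with c
... | p = refl
... | q = refl
... | r = ⊥-elim (c≢r refl)
... | s = refl

splitLastR-last : ∀ x {y} → All (_≢ r) y → splitLastR (x ++ r ∷ y) ≡ just (x , y)
splitLastR-last []      ny rewrite splitLastR-none ny = refl
splitLastR-last (c ∷ x) ny rewrite splitLastR-last x ny = refl

revBeforeLastR-none : ∀ {v} → All (_≢ r) v → revBeforeLastR v ≡ v
revBeforeLastR-none {v} nv rewrite splitLastR-none nv = refl

revBeforeLastR-last : ∀ x {y} → All (_≢ r) y → revBeforeLastR (x ++ r ∷ y) ≡ reverse x ++ r ∷ y
revBeforeLastR-last x ny rewrite splitLastR-last x ny = refl

length-revBeforeLastR : ∀ v → length (revBeforeLastR v) ≡ length v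
length-revBeforeLastR v with lastView ≡r? v
... | none nv   = cong length (revBeforeLastR-none nv)
... | last x {y} ny = begin
  length (revBeforeLastR (x ++ r ∷ y))  ≡⟨ cong length (revBeforeLastR-last x ny) ⟩
  length (reverse x ++ r ∷ y)           ≡⟨ length-++ (reverse x) ⟩
  length (reverse x) + length (r ∷ y)   ≡⟨ cong (_+ length (r ∷ y)) (length-reverse x) ⟩
  length x + length (r ∷ y)             ≡⟨ length-++ x ⟨
  length (x ++ r ∷ y)                   ∎
  where open ≡-Reasoning

revBeforeLastR-involutive : ∀ v → revBeforeLastR (revBeforeLastR v) ≡ v
revBeforeLastR-involutive v with lastView ≡r? v
... | none nv   = trans (cong revBeforeLastR (revBeforeLastR-none nv)) (revBeforeLastR-none nv)
... | last x {y} ny = begin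
  revBeforeLastR (revBeforeLastR (x ++ r ∷ y))  ≡⟨ cong revBeforeLastR (revBeforeLastR-last x ny) ⟩
  revBeforeLastR (reverse x ++ r ∷ y)           ≡⟨ revBeforeLastR-last (reverse x) ny ⟩
  reverse (reverse x) ++ r ∷ y                  ≡⟨ cong (_++ r ∷ y) (reverse-involutive x) ⟩
  x ++ r ∷ y                                    ∎
  where open ≡-Reasoning

substER-substRE : ∀ c → substER (substRE c) ≡ c
substER-substRE one = refl
substER-substRE two = refl
substER-substRE u   = refl
substER-substRE d   = refl

substRE-substER : ∀ c → substRE (substER c) ≡ c
substRE-substER p = refl
substRE-substER q = refl
substRE-substER r = refl
substRE-substER s = refl

substER∘substRE : ∀ w → map substER (map substRE w) ≡ w
substER∘substRE w = trans (sym (map-∘ w)) (trans (map-cong substER-substRE w) (map-id w))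

substRE∘substER : ∀ v → map substRE (map substER v) ≡ v
substRE∘substER v = trans (sym (map-∘ v)) (trans (map-cong substRE-substER v) (map-id v))

length-b : ∀ w → length (b w) ≡ length w
length-b w = trans (length-revBeforeLastR (map substRE w)) (length-map substRE w)

length-bInv : ∀ v → length (bInv v) ≡ length v
length-bInv v = trans (length-map substER (revBeforeLastR v)) (length-revBeforeLastR v)

bInv∘b : ∀ w → bInv (b w) ≡ w
bInv∘b w = trans (cong (map substER) (revBeforeLastR-involutive (map substRE w))) (substER∘substRE w)

b∘bInv : ∀ v → b (bInv v) ≡ v
b∘bInv v = trans (cong revBeforeLastR (substRE∘substER (revBeforeLastR v))) (revBeforeLastR-involutive v)

module _ {A : Set} where

  okHead : (A → A → Bool) → A → List A → Bool
  okHead R c []       = true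
  okHead R c (c′ ∷ _) = R c c′

  adjacentOk : (A → A → Bool) → List A → Bool
  adjacentOk R []      = true
  adjacentOk R (c ∷ x) = adjacentOk R x ∧ okHead R c x

  okLast : (A → A → Bool) → List A → A → Bool
  okLast R []           c = true
  okLast R (y ∷ [])     c = R y c
  okLast R (_ ∷ y ∷ ys) c = okLast R (y ∷ ys) c

  adjacentOk-∷ʳ : ∀ R ys c → adjacentOk R (ys ++ [ c ]) ≡ adjacentOk R ys ∧ okLast R ys c
  adjacentOk-∷ʳ R []           c = refl
  adjacentOk-∷ʳ R (y ∷ [])     c = refl
  adjacentOk-∷ʳ R (y ∷ y′ ∷ ys) c rewrite adjacentOk-∷ʳ R (y′ ∷ ys) c =
    swap (adjacentOk R (y′ ∷ ys)) (okLast R (y′ ∷ ys) c) (R y y′)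
    where
    swap : ∀ a l b → (a ∧ l) ∧ b ≡ (a ∧ b) ∧ l
    swap a l b = trans (∧-assoc a l b) (trans (cong (a ∧_) (∧-comm l b)) (sym (∧-assoc a b l)))

  okLast-∷ʳ : ∀ R ys z c → okLast R (ys ++ [ z ]) c ≡ R z c
  okLast-∷ʳ R []           z c = refl
  okLast-∷ʳ R (y ∷ [])     z c = refl
  okLast-∷ʳ R (y ∷ y′ ∷ ys) z c = okLast-∷ʳ R (y′ ∷ ys) z c

  okLast-reverse : ∀ R x c → okLast R (reverse x) c ≡ okHead (flip R) c x
  okLast-reverse R []      c = refl
  okLast-reverse R (z ∷ x) c = trans (cong (λ l → okLast R l c) (unfold-reverse z x)) (okLast-∷ʳ R (reverse x) z c)

  adjacentOk-reverse : ∀ R x → adjacentOk R (reverse x) ≡ adjacentOk (flip R) x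
  adjacentOk-reverse R []      = refl
  adjacentOk-reverse R (c ∷ x) = trans (cong (adjacentOk R) (unfold-reverse c x))
    (trans (adjacentOk-∷ʳ R (reverse x) c) (cong₂ _∧_ (adjacentOk-reverse R x) (okLast-reverse R x c)))

  adjacentOk-cong : ∀ R R′ → (∀ a a′ → R a a′ ≡ R′ a a′) → ∀ x → adjacentOk R x ≡ adjacentOk R′ x
  adjacentOk-cong R R′ R≗R′ []           = refl
  adjacentOk-cong R R′ R≗R′ (c ∷ [])     = refl
  adjacentOk-cong R R′ R≗R′ (c ∷ c′ ∷ x) = cong₂ _∧_ (adjacentOk-cong R R′ R≗R′ (c′ ∷ x)) (R≗R′ c c′)

adjacentOk-map : ∀ {A B : Set} (R : B → B → Bool) (f : A → B) x →
  adjacentOk R (map f x) ≡ adjacentOk (λ a a′ → R (f a) (f a′)) x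
adjacentOk-map R f []           = refl
adjacentOk-map R f (c ∷ [])     = refl
adjacentOk-map R f (c ∷ c′ ∷ x) = cong (_∧ R (f c) (f c′)) (adjacentOk-map R f (c′ ∷ x))

runFrom-nothing : ∀ {C S : Set} (δ : C → S → Maybe S) x → runFrom δ nothing x ≡ nothing
runFrom-nothing δ []      = refl
runFrom-nothing δ (c ∷ x) rewrite runFrom-nothing δ x = refl

-- An automaton whose state after reading x is determined by the head of x, and whose
-- transitions fail exactly at forbidden adjacent pairs, accepts the words avoiding them.
module LocalAutomaton {C S : Set} (δ : C → S → Maybe S) (ok : C → C → Bool) (state : List C → S)
  (δ-state : ∀ c x → δ c (state x) ≡ (if okHead ok c x then just (state (c ∷ x)) else nothing)) where

  runFrom-state : ∀ x → runFrom δ (just (state [])) x ≡ (if adjacentOk ok x then just (state x) else nothing)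
  runFrom-state []      = refl
  runFrom-state (c ∷ x) rewrite runFrom-state x with adjacentOk ok x
  ... | false = refl
  ... | true  = δ-state c x

  accepts : ∀ x → T (adjacentOk ok x) → runFrom δ (just (state [])) x ≡ just (state x)
  accepts x adj with adjacentOk ok x | runFrom-state x
  ... | true | e = e

  accepted⇒adjacentOk : ∀ x {st} → runFrom δ (just (state [])) x ≡ just st → T (adjacentOk ok x)
  accepted⇒adjacentOk x e with adjacentOk ok x | runFrom-state x
  ... | true  | _  = tt
  ... | false | e′ = case trans (sym e) e′ of λ ()

-- The rectangular language: 1…1, or x d 1…1 with no factor 21 or u1 in x

rectOk : RL → RL → Bool
rectOk two one = false
rectOk u   one = false
rectOk _   _   = true

rectState : List RL → RectState
rectState (one ∷ _) = rc-one
rectState _         = rc-other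

rectStep-state : ∀ c x → rectStep c (rectState x) ≡ (if okHead rectOk c x then just (rectState (c ∷ x)) else nothing)
rectStep-state one []          = refl
rectStep-state one (_ ∷ _)     = refl
rectStep-state two []          = refl
rectStep-state two (one ∷ _)   = refl
rectStep-state two (two ∷ _)   = refl
rectStep-state two (u ∷ _)     = refl
rectStep-state two (d ∷ _)     = refl
rectStep-state u   []          = refl
rectStep-state u   (one ∷ _)   = refl
rectStep-state u   (two ∷ _)   = refl
rectStep-state u   (u ∷ _)     = refl
rectStep-state u   (d ∷ _)     = refl
rectStep-state d   []          = refl
rectStep-state d   (one ∷ _)   = refl
rectStep-state d   (two ∷ _)   = refl
rectStep-state d   (u ∷ _)     = refl
rectStep-state d   (d ∷ _)     = refl

module RectLocal = LocalAutomaton rectStep rectOk rectState rectStep-state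

data RectWord : List RL → Set where
  ones    : ∀ n → RectWord (replicate n one)
  ends-d1 : ∀ x n → T (adjacentOk rectOk x) → RectWord (x ++ d ∷ replicate (suc n) one)

≡d? : ∀ c → Dec (c ≡ d)
≡d? one = no λ ()
≡d? two = no λ ()
≡d? u   = no λ ()
≡d? d   = yes refl

rectRun-ones : ∀ n → rectRun (replicate (suc n) one) ≡ just rc-one
rectRun-ones zero    = refl
rectRun-ones (suc n) rewrite rectRun-ones n = refl

rectRun-noD : ∀ y {st} → All (_≢ d) y → rectRun y ≡ just st →
  (y ≡ [] × st ≡ rc-empty) ⊎ Σ ℕ λ n → y ≡ replicate (suc n) one × st ≡ rc-one
rectRun-noD []      _          refl = inj₁ (refl , refl)
rectRun-noD (c ∷ y) (c≢d ∷ nd) e with rectRun y in ey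
... | just st₀ with rectRun-noD y nd ey | c | e
...   | inj₁ (refl , refl)    | one | refl = inj₂ (0 , refl , refl)
...   | inj₂ (n , refl , refl) | one | refl = inj₂ (suc n , refl , refl)
...   | _ | d | _ = ⊥-elim (c≢d refl)
...   | inj₁ (_ , refl) | two | ()
...   | inj₁ (_ , refl) | u   | ()
...   | inj₂ (_ , _ , refl) | two | ()
...   | inj₂ (_ , _ , refl) | u   | ()

rectRun-++ : ∀ x y → rectRun (x ++ y) ≡ runFrom rectStep (rectRun y) x
rectRun-++ x y = foldr-++ _ (just rc-empty) x y

rectWord⇒accepted : ∀ {w} → RectWord w → Σ RectState λ st → rectRun w ≡ just st
rectWord⇒accepted (ones zero)    = rc-empty , refl
rectWord⇒accepted (ones (suc n)) = rc-one , rectRun-ones n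
rectWord⇒accepted (ends-d1 x n adj) = rectState x , (begin
  rectRun (x ++ d ∷ replicate (suc n) one)                    ≡⟨ rectRun-++ x (d ∷ replicate (suc n) one) ⟩
  runFrom rectStep (rectRun (d ∷ replicate (suc n) one)) x    ≡⟨ cong (λ m → runFrom rectStep (m >>= rectStep d) x) (rectRun-ones n) ⟩
  runFrom rectStep (just rc-other) x                          ≡⟨ RectLocal.accepts x adj ⟩
  just (rectState x)                                          ∎)
  where open ≡-Reasoning

accepted⇒rectWord : ∀ w {st} → rectRun w ≡ just st → RectWord w
accepted⇒rectWord w e with lastView ≡d? w
... | none nd with rectRun-noD w nd e
...   | inj₁ (refl , _)       = ones 0
...   | inj₂ (n , refl , _)   = ones (suc n)
accepted⇒rectWord w e | last x {y} nd with trans (sym (rectRun-++ x (d ∷ y))) e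
... | e′ with rectRun y in ey
...   | nothing = case trans (sym (runFrom-nothing rectStep x)) e′ of λ ()
...   | just st₀ with rectRun-noD y nd ey
...     | inj₁ (refl , refl)     = case trans (sym (runFrom-nothing rectStep x)) e′ of λ ()
...     | inj₂ (n , refl , refl) = ends-d1 x n (RectLocal.accepted⇒adjacentOk x e′)

-- The evil-avoiding language: s…s, or x r s…s with no factor sp or sq in x

evilOk : EL → EL → Bool
evilOk s p = false
evilOk s q = false
evilOk _ _ = true

evilState : List EL → EvilState
evilState (p ∷ _) = ev-other
evilState (q ∷ _) = ev-other
evilState _       = ev-block

evilStep-state : ∀ c x → evilStep c (evilState x) ≡ (if okHead evilOk c x then just (evilState (c ∷ x)) else nothing)
evilStep-state s []        = refl
evilStep-state s (p ∷ _)   = refl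
evilStep-state s (q ∷ _)   = refl
evilStep-state s (r ∷ _)   = refl
evilStep-state s (s ∷ _)   = refl
evilStep-state r []        = refl
evilStep-state r (p ∷ _)   = refl
evilStep-state r (q ∷ _)   = refl
evilStep-state r (r ∷ _)   = refl
evilStep-state r (s ∷ _)   = refl
evilStep-state p []        = refl
evilStep-state p (p ∷ _)   = refl
evilStep-state p (q ∷ _)   = refl
evilStep-state p (r ∷ _)   = refl
evilStep-state p (s ∷ _)   = refl
evilStep-state q []        = refl
evilStep-state q (p ∷ _)   = refl
evilStep-state q (q ∷ _)   = refl
evilStep-state q (r ∷ _)   = refl
evilStep-state q (s ∷ _)   = refl

module EvilLocal = LocalAutomaton evilStep evilOk evilState evilStep-state

data EvilWord : List EL → Set where
  ones    : ∀ n → EvilWord (replicate n s)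
  ends-rs : ∀ x n → T (adjacentOk evilOk x) → EvilWord (x ++ r ∷ replicate (suc n) s)

evilRun-ones : ∀ n → evilRun (replicate (suc n) s) ≡ just ev-identity
evilRun-ones zero    = refl
evilRun-ones (suc n) rewrite evilRun-ones n = refl

evilRun-noR : ∀ y {st} → All (_≢ r) y → evilRun y ≡ just st →
  (y ≡ [] × st ≡ ev-empty) ⊎ Σ ℕ λ n → y ≡ replicate (suc n) s × st ≡ ev-identity
evilRun-noR []      _          refl = inj₁ (refl , refl)
evilRun-noR (c ∷ y) (c≢r ∷ nr) e with evilRun y in ey
... | just st₀ with evilRun-noR y nr ey | c | e
...   | inj₁ (refl , refl)    | s | refl = inj₂ (0 , refl , refl)
...   | inj₂ (n , refl , refl) | s | refl = inj₂ (suc n , refl , refl)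
...   | _ | r | _ = ⊥-elim (c≢r refl)
...   | inj₁ (_ , refl) | p | ()
...   | inj₁ (_ , refl) | q | ()
...   | inj₂ (_ , _ , refl) | p | ()
...   | inj₂ (_ , _ , refl) | q | ()

evilRun-++ : ∀ x y → evilRun (x ++ y) ≡ runFrom evilStep (evilRun y) x
evilRun-++ x y = foldr-++ _ (just ev-empty) x y

evilWord⇒accepted : ∀ {v} → EvilWord v → Σ EvilState λ st → evilRun v ≡ just st
evilWord⇒accepted (ones zero)    = ev-empty , refl
evilWord⇒accepted (ones (suc n)) = ev-identity , evilRun-ones n
evilWord⇒accepted (ends-rs x n adj) = evilState x , (begin
  evilRun (x ++ r ∷ replicate (suc n) s)                    ≡⟨ evilRun-++ x (r ∷ replicate (suc n) s) ⟩
  runFrom evilStep (evilRun (r ∷ replicate (suc n) s)) x    ≡⟨ cong (λ m → runFrom evilStep (m >>= evilStep r) x) (evilRun-ones n) ⟩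
  runFrom evilStep (just ev-block) x                        ≡⟨ EvilLocal.accepts x adj ⟩
  just (evilState x)                                        ∎)
  where open ≡-Reasoning

accepted⇒evilWord : ∀ v {st} → evilRun v ≡ just st → EvilWord v
accepted⇒evilWord v e with lastView ≡r? v
... | none nr with evilRun-noR v nr e
...   | inj₁ (refl , _)     = ones 0
...   | inj₂ (n , refl , _) = ones (suc n)
accepted⇒evilWord v e | last x {y} nr with trans (sym (evilRun-++ x (r ∷ y))) e
... | e′ with evilRun y in ey
...   | nothing = case trans (sym (runFrom-nothing evilStep x)) e′ of λ ()
...   | just st₀ with evilRun-noR y nr ey
...     | inj₁ (refl , refl)     = case trans (sym (runFrom-nothing evilStep x)) e′ of λ ()
...     | inj₂ (n , refl , refl) = ends-rs x n (EvilLocal.accepted⇒adjacentOk x e′)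

-- b exchanges the two languages

rectOk-substER : ∀ c c′ → rectOk (substER c′) (substER c) ≡ evilOk c c′
rectOk-substER p p = refl
rectOk-substER p q = refl
rectOk-substER p r = refl
rectOk-substER p s = refl
rectOk-substER q p = refl
rectOk-substER q q = refl
rectOk-substER q r = refl
rectOk-substER q s = refl
rectOk-substER r p = refl
rectOk-substER r q = refl
rectOk-substER r r = refl
rectOk-substER r s = refl
rectOk-substER s p = refl
rectOk-substER s q = refl
rectOk-substER s r = refl
rectOk-substER s s = refl

evilOk-substRE : ∀ c c′ → evilOk (substRE c′) (substRE c) ≡ rectOk c c′
evilOk-substRE c c′ = begin
  evilOk (substRE c′) (substRE c)                            ≡⟨ rectOk-substER (substRE c′) (substRE c) ⟨
  rectOk (substER (substRE c)) (substER (substRE c′))        ≡⟨ cong₂ rectOk (substER-substRE c) (substER-substRE c′) ⟩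
  rectOk c c′                                                ∎
  where open ≡-Reasoning

-- The forbidden factors 21, u1 become sp, sq read backwards.
adjacentOk-b : ∀ x → adjacentOk evilOk (reverse (map substRE x)) ≡ adjacentOk rectOk x
adjacentOk-b x = trans (adjacentOk-reverse evilOk (map substRE x))
  (trans (adjacentOk-map (flip evilOk) substRE x) (adjacentOk-cong _ rectOk evilOk-substRE x))

adjacentOk-bInv : ∀ x → adjacentOk rectOk (map substER (reverse x)) ≡ adjacentOk evilOk x
adjacentOk-bInv x = trans (adjacentOk-map rectOk substER (reverse x))
  (trans (adjacentOk-reverse _ x) (adjacentOk-cong _ evilOk rectOk-substER x))

noR-replicate : ∀ n → All (_≢ r) (replicate n s)
noR-replicate n = replicate⁺ n λ ()

b-rectWord : ∀ {w} → RectWord w → EvilWord (b w)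
b-rectWord (ones n) = subst EvilWord (sym (begin
  revBeforeLastR (map substRE (replicate n one))  ≡⟨ cong revBeforeLastR (map-replicate substRE n one) ⟩
  revBeforeLastR (replicate n s)                  ≡⟨ revBeforeLastR-none (noR-replicate n) ⟩
  replicate n s                                   ∎)) (ones n)
  where open ≡-Reasoning
b-rectWord (ends-d1 x n adj) = subst EvilWord (sym (begin
  revBeforeLastR (map substRE (x ++ d ∷ replicate (suc n) one))
      ≡⟨ cong revBeforeLastR (trans (map-++ substRE x _) (cong (λ y → map substRE x ++ r ∷ y) (map-replicate substRE (suc n) one))) ⟩
  revBeforeLastR (map substRE x ++ r ∷ replicate (suc n) s)
      ≡⟨ revBeforeLastR-last (map substRE x) (noR-replicate (suc n)) ⟩
  reverse (map substRE x) ++ r ∷ replicate (suc n) s  ∎))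
  (ends-rs (reverse (map substRE x)) n (subst T (sym (adjacentOk-b x)) adj))
  where open ≡-Reasoning

bInv-evilWord : ∀ {v} → EvilWord v → RectWord (bInv v)
bInv-evilWord (ones n) = subst RectWord (sym (begin
  map substER (revBeforeLastR (replicate n s))  ≡⟨ cong (map substER) (revBeforeLastR-none (noR-replicate n)) ⟩
  map substER (replicate n s)                   ≡⟨ map-replicate substER n s ⟩
  replicate n one                               ∎)) (ones n)
  where open ≡-Reasoning
bInv-evilWord (ends-rs x n adj) = subst RectWord (sym (begin
  map substER (revBeforeLastR (x ++ r ∷ replicate (suc n) s))
      ≡⟨ cong (map substER) (revBeforeLastR-last x (noR-replicate (suc n))) ⟩
  map substER (reverse x ++ r ∷ replicate (suc n) s)
      ≡⟨ trans (map-++ substER (reverse x) _) (cong (λ y → map substER (reverse x) ++ d ∷ y) (map-replicate substER (suc n) s)) ⟩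
  map substER (reverse x) ++ d ∷ replicate (suc n) one  ∎))
  (ends-d1 (map substER (reverse x)) n (subst T (sym (adjacentOk-bInv x)) adj))
  where open ≡-Reasoning

runR⇒rectWord : ∀ {w π} → RunR w π → RectWord w
runR⇒rectWord run with rect-run-sound run
... | _ , accepted , _ = accepted⇒rectWord _ accepted

rectWord⇒runR : ∀ {w} → RectWord w → Σ (List ℕ) (RunR w)
rectWord⇒runR {w} rw with rectWord⇒accepted rw
... | _ , accepted with rect-run-complete w accepted
...   | π , run , _ = π , run

runE⇒evilWord : ∀ {v π} → RunE v π → EvilWord v
runE⇒evilWord run with evil-run-sound run
... | _ , accepted , _ = accepted⇒evilWord _ accepted

evilWord⇒runE : ∀ {v} → EvilWord v → Σ (List ℕ) (RunE v)
evilWord⇒runE {v} ev with evilWord⇒accepted ev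
... | _ , accepted with evil-run-complete v accepted
...   | π , run , _ = π , run

≢[]-resp-length : ∀ {A B : Set} {xs : List A} {ys : List B} → length xs ≡ length ys → ys ≢ [] → xs ≢ []
≢[]-resp-length {ys = []}    _  ys≢[] _    = ys≢[] refl
≢[]-resp-length {ys = _ ∷ _} () _     refl

mainTheorem3 : (∀ w → length (b w) ≡ length w)
    × (∀ w → LRect w → LEvil (b w))
    × (∀ v → LEvil v → LRect (bInv v))
    × (∀ w → LRect w → bInv (b w) ≡ w)
    × (∀ v → LEvil v → b (bInv v) ≡ v)
mainTheorem3 =
  length-b ,
  (λ w (w≢[] , _ , run) → ≢[]-resp-length (length-b w) w≢[] , evilWord⇒runE (b-rectWord (runR⇒rectWord run))) ,
  (λ v (v≢[] , _ , run) → ≢[]-resp-length (length-bInv v) v≢[] , rectWord⇒runR (bInv-evilWord (runE⇒evilWord run))) ,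
  (λ w _ → bInv∘b w) ,
  (λ v _ → b∘bInv v)
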